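{- For $n\ge0$ let $\alpha_n$ be the minimal zero of $\phi_n(x)=((n+1)x^2-3x-n)U_n(x)+(x+1)(U_{n-1}(x)+1)$; for $n\ge2$ let $\beta_n$ be the minimal zero of $U^{\mathrm{e}}_n(x)$ and $\gamma_n$ the minimal zero of $S_n(x)$. Then $\alpha_0=1$, $\alpha_1=-1/2$, and for $n\ge2$, \[ \alpha_n=\min\{\beta_n,\gamma_n\}=\begin{cases}\beta_n & \text{if } n \text{ is even},\\ \gamma_n & \text{if } n\ge3 \text{ is odd}.\end{cases} \]
   Context: $U_m(x)$ is the Chebyshev polynomial of the second kind, $U_m(\cos\theta)=\sin((m+1)\theta)/\sin\theta$, with $U_{ -1}(x)=0$. The partial Chebyshev polynomial $U^{\mathrm{e}}_n$ is defined, with $x=\cos\theta$, by $U^{\mathrm{e}}_n(x)=\dfrac{\sin((n+1)\theta/2)}{\sin(\theta/2)}$ if $n$ is even and $U^{\mathrm{e}}_n(x)=\dfrac{\sin((n+1)\theta/2)}{\sin\theta}$ if $n$ is odd. The polynomials $S_n$ are defined for $m\ge0$ by $S_{2m}(x)=(2mx+x+2m-1)U_m(x)-(2mx+3x+2m+1)U_{m-1}(x)$ and $S_{2m+1}(x)=2(2mx^2+2x^2+2mx-x-1)U_m(x)-2(2mx+3x+2m+1)U_{m-1}(x)$. -}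

module Defs where

open import Level using (_⊔_; suc)
open import Algebra.Bundles using (CommutativeRing)
open import Relation.Binary.Core using (Rel)
open import Relation.Binary.Structures using (IsStrictTotalOrder)
open import Relation.Nullary using (¬_)
open import Data.Nat as ℕ using (ℕ; zero) renaming (suc to 1+)
open import Data.List using (List; []; _∷_)
open import Data.Product using (Σ; _×_; ∃)
open import Data.Sum using (_⊎_; inj₁; inj₂; [_,_])

-- A real closed field, axiomatised as an ordered field in which every
-- polynomial satisfies the intermediate value property.
evalPoly : ∀ {c ℓ} (K : CommutativeRing c ℓ) →
           List (CommutativeRing.Carrier K) → CommutativeRing.Carrier K → CommutativeRing.Carrier K
evalPoly K []       x = CommutativeRing.0# K
evalPoly K (a ∷ as) x = CommutativeRing._+_ K a (CommutativeRing._*_ K x (evalPoly K as x))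

record RealClosedField (c ℓ : Level.Level) : Set (Level.suc (c ⊔ ℓ)) where
  field
    commutativeRing : CommutativeRing c ℓ
  open CommutativeRing commutativeRing public
  field
    _<_                 : Rel Carrier ℓ
    <-isStrictTotalOrder : IsStrictTotalOrder _≈_ _<_
    0<1                 : 0# < 1#
    +-monoˡ-<           : ∀ {x y} z → x < y → (x + z) < (y + z)
    *-pos               : ∀ {x y} → 0# < x → 0# < y → 0# < (x * y)
    inverse             : ∀ x → ¬ (x ≈ 0#) → ∃ λ y → (x * y) ≈ 1#
    ivt                 : ∀ (p : List Carrier) a b → a < b →
                          evalPoly commutativeRing p a < 0# → 0# < evalPoly commutativeRing p b →
                          ∃ λ c → (a < c) × (c < b) × (evalPoly commutativeRing p c ≈ 0#)

-- parity view: inj₁ m means n = 2m, inj₂ m means n = 2m+1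
halfParity : ℕ → ℕ ⊎ ℕ
halfParity zero   = inj₁ 0
halfParity (1+ n) = [ (λ m → inj₂ m) , (λ m → inj₁ (1+ m)) ] (halfParity n)

module RCF {c ℓ} (R : RealClosedField c ℓ) where
  open RealClosedField R

  _≤_ : Rel Carrier ℓ
  x ≤ y = (x < y) ⊎ (x ≈ y)

  fromℕ : ℕ → Carrier
  fromℕ zero   = 0#
  fromℕ (1+ n) = 1# + fromℕ n

  -- Ũ k = U_{k-1}  (so Ũ 0 = U_{-1} = 0, Ũ 1 = U_0 = 1)
  Ũ : ℕ → Carrier → Carrier
  Ũ zero          x = 0#
  Ũ (1+ zero)     x = 1#
  Ũ (1+ (1+ k))   x = ((x + x) * Ũ (1+ k) x) - Ũ k x

  U : ℕ → Carrier → Carrier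
  U m = Ũ (1+ m)

  Uprev : ℕ → Carrier → Carrier
  Uprev m = Ũ m

  -- partial Chebyshev polynomial U^e_n written in x = cos θ:
  --   U^e_{2k}   = sin((2k+1)θ/2)/sin(θ/2) = U_k + U_{k-1}
  --   U^e_{2k+1} = sin((k+1)θ)/sin θ       = U_k
  Ue : ℕ → Carrier → Carrier
  Ue n x = [ (λ k → U k x + Uprev k x) , (λ k → U k x) ] (halfParity n)

  Seven : ℕ → Carrier → Carrier
  Seven m x = (((fromℕ (2 ℕ.* m) * x) + x + fromℕ (2 ℕ.* m)) - 1#) * U m x
            - ((fromℕ (2 ℕ.* m) * x) + (fromℕ 3 * x) + fromℕ (2 ℕ.* m) + 1#) * Uprev m x

  Sodd : ℕ → Carrier → Carrier
  Sodd m x = fromℕ 2 * ((((fromℕ (2 ℕ.* m) * (x * x)) + (fromℕ 2 * (x * x))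
                          + (fromℕ (2 ℕ.* m) * x)) - x) - 1#) * U m x
           - fromℕ 2 * ((fromℕ (2 ℕ.* m) * x) + (fromℕ 3 * x) + fromℕ (2 ℕ.* m) + 1#) * Uprev m x

  S : ℕ → Carrier → Carrier
  S n x = [ (λ m → Seven m x) , (λ m → Sodd m x) ] (halfParity n)

  φ : ℕ → Carrier → Carrier
  φ n x = ((((fromℕ (1+ n) * (x * x)) - (fromℕ 3 * x)) - fromℕ n) * U n x)
        + ((x + 1#) * (Uprev n x + 1#))

  IsMinZero : (Carrier → Carrier) → Carrier → Set (c ⊔ ℓ)
  IsMinZero f a = (f a ≈ 0#) × (∀ y → f y ≈ 0# → a ≤ y)

  IsMinOf : Carrier → Carrier → Carrier → Set ℓ
  IsMinOf a b c' = ((a ≈ b) ⊎ (a ≈ c')) × (a ≤ b) × (a ≤ c')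

-- The addition formula and Cassini's identity for U factor φ_n as
-- (x − 1) U^e_n S_n for n ≥ 2, and S_n(1) = 0, so the least zero of φ_n is min{β_n, γ_n}.
-- Both U_k and U^e_{2k} = U_k + U_{k−1} satisfy the Chebyshev recurrence and have sign (−1)^k on
-- (−∞, −1], so by the IVT their least zeros lie in (−1, 1) and strictly decrease with k.
-- For n = 2m, telescoping the recurrence below β_n shows (−1)^m S_{2m} < 0 there, hence β_n ≤ γ_n.
-- For n = 2m + 1, Cassini gives U_{n−1} = 1 at the least zero σ of U_n, so φ_n(−1) < 0 < φ_n(σ);
-- the zero of φ_n in between lies below σ ≤ β_n and is a zero of S_n, hence γ_n < β_n.
-- Least zeros exist because the polynomial IVT lets one list all zeros of a polynomial in an
-- interval, by induction on the degree: between consecutive zeros of p′, p is strictly monotone.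
-- Monotonicity in turn comes from counting zeros: if p′ > 0 on [s, t] but p(t) ≤ p(s), a suitable
-- combination of p and a linear function would have more zeros than its degree allows.

module Submission where

open import Level using (Level; _⊔_)
open import Algebra.Bundles using (CommutativeRing)
open import Defs
open import Data.Nat as ℕ using (ℕ; zero; suc; s≤s)
open import Data.Integer as ℤ using (ℤ; +_; -[1+_]; _⊖_)
import Data.Integer.Properties as ℤ
import Data.Nat.Properties as ℕ
open import Data.Maybe using (Maybe; just; nothing)
open import Data.List using (List; []; _∷_; _++_; length; map; filter; concat; cartesianProductWith)
open import Data.List.Relation.Unary.Any as Any using (Any; here; there; any?)
import Data.List.Relation.Unary.Any.Properties as Any
open import Data.List.Relation.Unary.All as All using (All; []; _∷_)
open import Data.List.Relation.Unary.AllPairs using (AllPairs; []; _∷_)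
open import Function using (_∘_; id)
open import Data.List.Relation.Binary.Pointwise using (Pointwise; []; _∷_)
open import Relation.Nullary using (¬_; Dec; yes; no; contradiction)
open import Relation.Nullary.Decidable using (_×-dec_)
open import Relation.Binary.Definitions using (Tri; tri<; tri≈; tri>)
open import Relation.Binary.Structures using (IsStrictTotalOrder)
open import Relation.Binary.Bundles using (StrictTotalOrder; DecTotalOrder)
open import Data.Sum using (_⊎_; inj₁; inj₂; [_,_]′)
import Relation.Binary.PropositionalEquality as ≡
open ≡ using (_≡_)
open import Data.Product using (Σ; _×_; _,_; ∃; proj₁; proj₂; uncurry)
import Relation.Binary.Reasoning.Setoid as SetoidReasoning

module IntegerCoefficientSolver {c ℓ} (K : CommutativeRing c ℓ) where
  open CommutativeRing K
  open import Algebra.Properties.Semiring.Mult.TCOptimised semiring using (×-homo-+; ×1-homo-*) renaming (_×_ to _·_)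
  open import Algebra.Properties.Ring ring using (-‿distribˡ-*; -‿distribʳ-*)
  open import Algebra.Properties.AbelianGroup +-abelianGroup using (⁻¹-∙-comm; ⁻¹-involutive; ε⁻¹≈ε; xyx⁻¹≈y)
  import Algebra.Solver.Ring.AlmostCommutativeRing as ACR
  import Algebra.Solver.Ring as RingSolver
  open SetoidReasoning setoid

  ⟦_⟧ : ℤ → Carrier
  ⟦ + n ⟧      = n · 1#
  ⟦ -[1+ n ] ⟧ = - (suc n · 1#)

  ⟦⟧-homo-neg : ∀ i → ⟦ ℤ.- i ⟧ ≈ - ⟦ i ⟧
  ⟦⟧-homo-neg (+ zero)  = sym ε⁻¹≈ε
  ⟦⟧-homo-neg (+ suc n) = refl
  ⟦⟧-homo-neg -[1+ n ]  = sym (⁻¹-involutive _)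

  ⟦⟧-homo-⊖ : ∀ m n → ⟦ m ⊖ n ⟧ ≈ m · 1# - n · 1#
  ⟦⟧-homo-⊖ zero    zero    = sym (-‿inverseʳ 0#)
  ⟦⟧-homo-⊖ (suc m) zero    = sym (trans (+-congˡ ε⁻¹≈ε) (+-identityʳ _))
  ⟦⟧-homo-⊖ zero    (suc n) = sym (+-identityˡ _)
  ⟦⟧-homo-⊖ (suc m) (suc n) = begin
    ⟦ suc m ⊖ suc n ⟧               ≡⟨ ≡.cong ⟦_⟧ (ℤ.[1+m]⊖[1+n]≡m⊖n m n) ⟩
    ⟦ m ⊖ n ⟧                       ≈⟨ ⟦⟧-homo-⊖ m n ⟩
    M - N                           ≈⟨ +-congʳ (xyx⁻¹≈y 1# M) ⟨
    ((1# + M) - 1#) - N             ≈⟨ +-assoc _ _ _ ⟩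
    (1# + M) + (- 1# - N)           ≈⟨ +-congˡ (⁻¹-∙-comm 1# N) ⟩
    (1# + M) - (1# + N)             ≈⟨ +-cong (×-homo-+ 1# 1 m) (-‿cong (×-homo-+ 1# 1 n)) ⟨
    suc m · 1# - suc n · 1#         ∎
    where M = m · 1#
          N = n · 1#

  ⟦⟧-homo-+ : ∀ i j → ⟦ i ℤ.+ j ⟧ ≈ ⟦ i ⟧ + ⟦ j ⟧
  ⟦⟧-homo-+ (+ m)    (+ n)    = ×-homo-+ 1# m n
  ⟦⟧-homo-+ (+ m)    -[1+ n ] = ⟦⟧-homo-⊖ m (suc n)
  ⟦⟧-homo-+ -[1+ m ] (+ n)    = trans (⟦⟧-homo-⊖ n (suc m)) (+-comm _ _)
  ⟦⟧-homo-+ -[1+ m ] -[1+ n ] = begin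
    ⟦ -[1+ m ] ℤ.+ -[1+ n ] ⟧             ≡⟨ ≡.cong ⟦_⟧ (ℤ.neg-distrib-+ (+ suc m) (+ suc n)) ⟨
    ⟦ ℤ.- (+ suc m ℤ.+ + suc n) ⟧         ≈⟨ ⟦⟧-homo-neg (+ (suc m ℕ.+ suc n)) ⟩
    - ⟦ + (suc m ℕ.+ suc n) ⟧             ≈⟨ -‿cong (×-homo-+ 1# (suc m) (suc n)) ⟩
    - (suc m · 1# + suc n · 1#)           ≈⟨ ⁻¹-∙-comm _ _ ⟨
    ⟦ -[1+ m ] ⟧ + ⟦ -[1+ n ] ⟧           ∎

  ⟦⟧-homo-* : ∀ i j → ⟦ i ℤ.* j ⟧ ≈ ⟦ i ⟧ * ⟦ j ⟧
  ⟦⟧-homo-* (+ m)    (+ n)    = begin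
    ⟦ + m ℤ.* + n ⟧                       ≡⟨ ≡.cong ⟦_⟧ (ℤ.pos-* m n) ⟨
    ⟦ + (m ℕ.* n) ⟧                       ≈⟨ ×1-homo-* m n ⟩
    ⟦ + m ⟧ * ⟦ + n ⟧                     ∎
  ⟦⟧-homo-* (+ m)    -[1+ n ] = begin
    ⟦ + m ℤ.* ℤ.- + suc n ⟧               ≡⟨ ≡.cong ⟦_⟧ (ℤ.neg-distribʳ-* (+ m) (+ suc n)) ⟨
    ⟦ ℤ.- (+ m ℤ.* + suc n) ⟧             ≡⟨ ≡.cong (λ k → ⟦ ℤ.- k ⟧) (ℤ.pos-* m (suc n)) ⟨
    ⟦ ℤ.- (+ (m ℕ.* suc n)) ⟧             ≈⟨ ⟦⟧-homo-neg (+ (m ℕ.* suc n)) ⟩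
    - ⟦ + (m ℕ.* suc n) ⟧                 ≈⟨ -‿cong (×1-homo-* m (suc n)) ⟩
    - (m · 1# * suc n · 1#)               ≈⟨ -‿distribʳ-* _ _ ⟩
    ⟦ + m ⟧ * ⟦ -[1+ n ] ⟧                ∎
  ⟦⟧-homo-* -[1+ m ] (+ n)    = begin
    ⟦ ℤ.- + suc m ℤ.* + n ⟧               ≡⟨ ≡.cong ⟦_⟧ (ℤ.neg-distribˡ-* (+ suc m) (+ n)) ⟨
    ⟦ ℤ.- (+ suc m ℤ.* + n) ⟧             ≡⟨ ≡.cong (λ k → ⟦ ℤ.- k ⟧) (ℤ.pos-* (suc m) n) ⟨
    ⟦ ℤ.- (+ (suc m ℕ.* n)) ⟧             ≈⟨ ⟦⟧-homo-neg (+ (suc m ℕ.* n)) ⟩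
    - ⟦ + (suc m ℕ.* n) ⟧                 ≈⟨ -‿cong (×1-homo-* (suc m) n) ⟩
    - (suc m · 1# * n · 1#)               ≈⟨ -‿distribˡ-* _ _ ⟩
    ⟦ -[1+ m ] ⟧ * ⟦ + n ⟧                ∎
  ⟦⟧-homo-* -[1+ m ] -[1+ n ] = begin
    ⟦ + (suc m ℕ.* suc n) ⟧               ≈⟨ ×1-homo-* (suc m) (suc n) ⟩
    M * N                                 ≈⟨ ⁻¹-involutive _ ⟨
    - - (M * N)                           ≈⟨ -‿cong (-‿distribˡ-* M N) ⟩
    - (- M * N)                           ≈⟨ -‿distribʳ-* (- M) N ⟩
    - M * - N                             ∎
    where M = suc m · 1#
          N = suc n · 1#

  ℤ⟶K : ℤ.+-*-rawRing ACR.-Raw-AlmostCommutative⟶ ACR.fromCommutativeRing K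
  ℤ⟶K = record
    { ⟦_⟧    = ⟦_⟧
    ; +-homo = ⟦⟧-homo-+
    ; *-homo = ⟦⟧-homo-*
    ; -‿homo = ⟦⟧-homo-neg
    ; 0-homo = refl
    ; 1-homo = refl
    }

  ⟦⟧-≟ : ∀ i j → Maybe (⟦ i ⟧ ≈ ⟦ j ⟧)
  ⟦⟧-≟ i j with i ℤ.≟ j
  ... | yes ≡.refl = just refl
  ... | no _       = nothing

  open RingSolver ℤ.+-*-rawRing (ACR.fromCommutativeRing K) ℤ⟶K ⟦⟧-≟ public
    using (Polynomial; solve; _:=_; _:+_; _:-_; _:*_; :-_; con)

module PolynomialArithmetic {c ℓ} (K : CommutativeRing c ℓ) where
  open CommutativeRing K
  open import Algebra.Properties.Ring ring using (-1*x≈-x)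
  open IntegerCoefficientSolver K
  open SetoidReasoning setoid

  Poly : Set c
  Poly = List Carrier

  eval : Poly → Carrier → Carrier
  eval = evalPoly K

  eval-cong : ∀ p {x y} → x ≈ y → eval p x ≈ eval p y
  eval-cong []      x≈y = refl
  eval-cong (a ∷ p) x≈y = +-congˡ (*-cong x≈y (eval-cong p x≈y))

  eval-resp-≋ : ∀ {p q} → Pointwise _≈_ p q → ∀ x → eval p x ≈ eval q x
  eval-resp-≋ []             x = refl
  eval-resp-≋ (a≈b ∷ p≋q) x = +-cong a≈b (*-congˡ (eval-resp-≋ p≋q x))

  IsZero : Poly → Set (c ⊔ ℓ)
  IsZero = All (_≈ 0#)

  IsZero⇒eval≈0 : ∀ {p} → IsZero p → ∀ x → eval p x ≈ 0#
  IsZero⇒eval≈0 []           x = refl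
  IsZero⇒eval≈0 (a≈0 ∷ p≈0) x = trans (+-cong a≈0 (trans (*-congˡ (IsZero⇒eval≈0 p≈0 x)) (zeroʳ x))) (+-identityʳ 0#)

  infixl 6 _⊕_
  _⊕_ : Poly → Poly → Poly
  []      ⊕ q       = q
  (a ∷ p) ⊕ []      = a ∷ p
  (a ∷ p) ⊕ (b ∷ q) = (a + b) ∷ (p ⊕ q)

  eval-⊕ : ∀ p q x → eval (p ⊕ q) x ≈ eval p x + eval q x
  eval-⊕ []      q       x = sym (+-identityˡ _)
  eval-⊕ (a ∷ p) []      x = sym (+-identityʳ _)
  eval-⊕ (a ∷ p) (b ∷ q) x = begin
    (a + b) + x * eval (p ⊕ q) x             ≈⟨ +-congˡ (*-congˡ (eval-⊕ p q x)) ⟩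
    (a + b) + x * (eval p x + eval q x)      ≈⟨ solve 5 (λ a b x e f → (a :+ b) :+ x :* (e :+ f) := (a :+ x :* e) :+ (b :+ x :* f)) refl a b x (eval p x) (eval q x) ⟩
    (a + x * eval p x) + (b + x * eval q x)  ∎

  scale : Carrier → Poly → Poly
  scale k = map (k *_)

  eval-scale : ∀ k p x → eval (scale k p) x ≈ k * eval p x
  eval-scale k []      x = sym (zeroʳ k)
  eval-scale k (a ∷ p) x = begin
    k * a + x * eval (scale k p) x  ≈⟨ +-congˡ (*-congˡ (eval-scale k p x)) ⟩
    k * a + x * (k * eval p x)      ≈⟨ solve 4 (λ k a x e → k :* a :+ x :* (k :* e) := k :* (a :+ x :* e)) refl k a x (eval p x) ⟩
    k * (a + x * eval p x)          ∎

  negate : Poly → Poly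
  negate = scale (- 1#)

  eval-negate : ∀ p x → eval (negate p) x ≈ - eval p x
  eval-negate p x = trans (eval-scale (- 1#) p x) (-1*x≈-x (eval p x))

  addConst : Carrier → Poly → Poly
  addConst v []      = v ∷ []
  addConst v (a ∷ p) = (a + v) ∷ p

  eval-addConst : ∀ v p x → eval (addConst v p) x ≈ eval p x + v
  eval-addConst v []      x = solve 2 (λ v x → v :+ x :* con (+ 0) := con (+ 0) :+ v) refl v x
  eval-addConst v (a ∷ p) x = solve 4 (λ v a x e → (a :+ v) :+ x :* e := (a :+ x :* e) :+ v) refl v a x (eval p x)

  infixl 7 _⊛_
  _⊛_ : Poly → Poly → Poly
  []      ⊛ q = []
  (a ∷ p) ⊛ q = scale a q ⊕ (0# ∷ p ⊛ q)

  eval-⊛ : ∀ p q x → eval (p ⊛ q) x ≈ eval p x * eval q x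
  eval-⊛ []      q x = sym (zeroˡ _)
  eval-⊛ (a ∷ p) q x = begin
    eval (scale a q ⊕ (0# ∷ p ⊛ q)) x               ≈⟨ eval-⊕ (scale a q) (0# ∷ p ⊛ q) x ⟩
    eval (scale a q) x + (0# + x * eval (p ⊛ q) x)  ≈⟨ +-cong (eval-scale a q x) (+-congˡ (*-congˡ (eval-⊛ p q x))) ⟩
    a * eval q x + (0# + x * (eval p x * eval q x)) ≈⟨ solve 4 (λ a x e f → a :* f :+ (con (+ 0) :+ x :* (e :* f)) := (a :+ x :* e) :* f) refl a x (eval p x) (eval q x) ⟩
    (a + x * eval p x) * eval q x                   ∎

  IsPolynomial : (Carrier → Carrier) → Set (c ⊔ ℓ)
  IsPolynomial f = Σ Poly λ p → ∀ x → eval p x ≈ f x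

  infixl 6 _+ᴾ_ _−ᴾ_
  infixl 7 _*ᴾ_

  constᴾ : ∀ k → IsPolynomial (λ _ → k)
  constᴾ k = k ∷ [] , λ x → trans (+-congˡ (zeroʳ x)) (+-identityʳ k)

  idᴾ : IsPolynomial (λ x → x)
  idᴾ = 0# ∷ 1# ∷ [] , solve 1 (λ x → con (+ 0) :+ x :* (con (+ 1) :+ x :* con (+ 0)) := x) refl

  _+ᴾ_ : ∀ {f g} → IsPolynomial f → IsPolynomial g → IsPolynomial (λ x → f x + g x)
  (p , p≈f) +ᴾ (q , q≈g) = p ⊕ q , λ x → trans (eval-⊕ p q x) (+-cong (p≈f x) (q≈g x))

  _*ᴾ_ : ∀ {f g} → IsPolynomial f → IsPolynomial g → IsPolynomial (λ x → f x * g x)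
  (p , p≈f) *ᴾ (q , q≈g) = p ⊛ q , λ x → trans (eval-⊛ p q x) (*-cong (p≈f x) (q≈g x))

  _−ᴾ_ : ∀ {f g} → IsPolynomial f → IsPolynomial g → IsPolynomial (λ x → f x - g x)
  (p , p≈f) −ᴾ (q , q≈g) = p ⊕ negate q , λ x → trans (eval-⊕ p (negate q) x) (+-cong (p≈f x) (trans (eval-negate q x) (-‿cong (q≈g x))))

  quotient : Carrier → Poly → Poly
  quotient r []           = []
  quotient r (a ∷ [])     = []
  quotient r (a ∷ b ∷ bs) = eval (b ∷ bs) r ∷ quotient r (b ∷ bs)

  remainder-theorem : ∀ r p x → eval p x ≈ (x - r) * eval (quotient r p) x + eval p r
  remainder-theorem r []           x = solve 2 (λ r x → con (+ 0) := (x :- r) :* con (+ 0) :+ con (+ 0)) refl r x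
  remainder-theorem r (a ∷ [])     x = solve 3 (λ r x a → a :+ x :* con (+ 0) := (x :- r) :* con (+ 0) :+ (a :+ r :* con (+ 0))) refl r x a
  remainder-theorem r (a ∷ b ∷ bs) x = begin
    a + x * eval (b ∷ bs) x                ≈⟨ +-congˡ (*-congˡ (remainder-theorem r (b ∷ bs) x)) ⟩
    a + x * ((x - r) * Q + Pr)             ≈⟨ solve 5 (λ a x r Q Pr → a :+ x :* ((x :- r) :* Q :+ Pr) := (x :- r) :* (Pr :+ x :* Q) :+ (a :+ r :* Pr)) refl a x r Q Pr ⟩
    (x - r) * (Pr + x * Q) + (a + r * Pr)  ∎
    where Q  = eval (quotient r (b ∷ bs)) x
          Pr = eval (b ∷ bs) r

  remainder-theorem-root : ∀ {r} p x → eval p r ≈ 0# → eval p x ≈ (x - r) * eval (quotient r p) x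
  remainder-theorem-root {r} p x pr≈0 = trans (remainder-theorem r p x) (trans (+-congˡ pr≈0) (+-identityʳ _))

  length-quotient : ∀ r p → length (quotient r p) ≡ ℕ.pred (length p)
  length-quotient r []           = ≡.refl
  length-quotient r (a ∷ [])     = ≡.refl
  length-quotient r (a ∷ b ∷ bs) = ≡.cong suc (length-quotient r (b ∷ bs))

  quotient-root⇒IsZero : ∀ r p → IsZero (quotient r p) → eval p r ≈ 0# → IsZero p
  quotient-root⇒IsZero r []           _           _    = []
  quotient-root⇒IsZero r (a ∷ [])     _           pr≈0 = trans (sym (trans (+-congˡ (zeroʳ r)) (+-identityʳ a))) pr≈0 ∷ []
  quotient-root⇒IsZero r (a ∷ b ∷ bs) (qr≈0 ∷ q≈0) pr≈0 = a≈0 ∷ quotient-root⇒IsZero r (b ∷ bs) q≈0 qr≈0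
    where a≈0 = trans (sym (trans (+-congˡ (trans (*-congˡ qr≈0) (zeroʳ r))) (+-identityʳ a))) pr≈0

  -- eval (quotient x p) y is the divided difference (p y − p x)/(y − x).
  quotient-sym : ∀ x y p → eval (quotient x p) y ≈ eval (quotient y p) x
  quotient-sym x y []           = refl
  quotient-sym x y (a ∷ [])     = refl
  quotient-sym x y (a ∷ b ∷ bs) = begin
    Px + y * Qx                ≈⟨ +-cong (remainder-theorem y (b ∷ bs) x) (*-congˡ (quotient-sym x y (b ∷ bs))) ⟩
    ((x - y) * Qy + Py) + y * Qy ≈⟨ solve 4 (λ x y Q Py → ((x :- y) :* Q :+ Py) :+ y :* Q := Py :+ x :* Q) refl x y Qy Py ⟩
    Py + x * Qy                ∎
    where Px = eval (b ∷ bs) x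
          Py = eval (b ∷ bs) y
          Qx = eval (quotient x (b ∷ bs)) y
          Qy = eval (quotient y (b ∷ bs)) x

  quotient-comm : ∀ x y p → Pointwise _≈_ (quotient y (quotient x p)) (quotient x (quotient y p))
  quotient-comm x y []               = []
  quotient-comm x y (a ∷ [])         = []
  quotient-comm x y (a ∷ b ∷ [])     = []
  quotient-comm x y (a ∷ b ∷ d ∷ ds) = quotient-sym x y (b ∷ d ∷ ds) ∷ quotient-comm x y (b ∷ d ∷ ds)

  -- derivativeFrom k p = k p + X p′
  derivativeFrom : Carrier → Poly → Poly
  derivativeFrom k []      = []
  derivativeFrom k (a ∷ p) = k * a ∷ derivativeFrom (k + 1#) p

  derivative : Poly → Poly
  derivative []      = []
  derivative (a ∷ p) = derivativeFrom 1# p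

  derivative-addConst : ∀ v p → derivative (addConst v p) ≡ derivative p
  derivative-addConst v []      = ≡.refl
  derivative-addConst v (a ∷ p) = ≡.refl

  length-derivativeFrom : ∀ k p → length (derivativeFrom k p) ≡ length p
  length-derivativeFrom k []      = ≡.refl
  length-derivativeFrom k (a ∷ p) = ≡.cong suc (length-derivativeFrom (k + 1#) p)

  eval-derivativeFrom-suc : ∀ k p x → eval (derivativeFrom (k + 1#) p) x ≈ eval (derivativeFrom k p) x + eval p x
  eval-derivativeFrom-suc k []      x = sym (+-identityˡ 0#)
  eval-derivativeFrom-suc k (a ∷ p) x = begin
    (k + 1#) * a + x * eval (derivativeFrom ((k + 1#) + 1#) p) x  ≈⟨ +-congˡ (*-congˡ (eval-derivativeFrom-suc (k + 1#) p x)) ⟩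
    (k + 1#) * a + x * (D + eval p x)                            ≈⟨ solve 5 (λ k a x D E → (k :+ con (+ 1)) :* a :+ x :* (D :+ E) := (k :* a :+ x :* D) :+ (a :+ x :* E)) refl k a x D (eval p x) ⟩
    (k * a + x * D) + (a + x * eval p x)                          ∎
    where D = eval (derivativeFrom (k + 1#) p) x

  derivative≈quotient : ∀ r p → eval (derivative p) r ≈ eval (quotient r p) r
  derivative≈quotient r []           = refl
  derivative≈quotient r (a ∷ [])     = refl
  derivative≈quotient r (a ∷ b ∷ bs) = begin
    1# * b + r * eval (derivativeFrom (1# + 1#) bs) r      ≈⟨ +-congˡ (*-congˡ (eval-derivativeFrom-suc 1# bs r)) ⟩
    1# * b + r * (eval (derivative (b ∷ bs)) r + eval bs r) ≈⟨ solve 4 (λ b r D E → con (+ 1) :* b :+ r :* (D :+ E) := (b :+ r :* E) :+ r :* D) refl b r (eval (derivative (b ∷ bs)) r) (eval bs r) ⟩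
    eval (b ∷ bs) r + r * eval (derivative (b ∷ bs)) r     ≈⟨ +-congˡ (*-congˡ (derivative≈quotient r (b ∷ bs))) ⟩
    eval (b ∷ bs) r + r * eval (quotient r (b ∷ bs)) r     ∎

  eval-derivativeFrom-⊕ : ∀ k p q x → eval (derivativeFrom k (p ⊕ q)) x ≈ eval (derivativeFrom k p) x + eval (derivativeFrom k q) x
  eval-derivativeFrom-⊕ k []      q       x = sym (+-identityˡ _)
  eval-derivativeFrom-⊕ k (a ∷ p) []      x = sym (+-identityʳ _)
  eval-derivativeFrom-⊕ k (a ∷ p) (b ∷ q) x = begin
    k * (a + b) + x * eval (derivativeFrom (k + 1#) (p ⊕ q)) x  ≈⟨ +-congˡ (*-congˡ (eval-derivativeFrom-⊕ (k + 1#) p q x)) ⟩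
    k * (a + b) + x * (D + E)                                  ≈⟨ solve 6 (λ k a b x D E → k :* (a :+ b) :+ x :* (D :+ E) := (k :* a :+ x :* D) :+ (k :* b :+ x :* E)) refl k a b x D E ⟩
    (k * a + x * D) + (k * b + x * E)                          ∎
    where D = eval (derivativeFrom (k + 1#) p) x
          E = eval (derivativeFrom (k + 1#) q) x

  eval-derivative-⊕ : ∀ p q x → eval (derivative (p ⊕ q)) x ≈ eval (derivative p) x + eval (derivative q) x
  eval-derivative-⊕ []      q       x = sym (+-identityˡ _)
  eval-derivative-⊕ (a ∷ p) []      x = sym (+-identityʳ _)
  eval-derivative-⊕ (a ∷ p) (b ∷ q) x = eval-derivativeFrom-⊕ 1# p q x

  eval-derivativeFrom-scale : ∀ k v p x → eval (derivativeFrom k (scale v p)) x ≈ v * eval (derivativeFrom k p) x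
  eval-derivativeFrom-scale k v []      x = sym (zeroʳ v)
  eval-derivativeFrom-scale k v (a ∷ p) x = begin
    k * (v * a) + x * eval (derivativeFrom (k + 1#) (scale v p)) x  ≈⟨ +-congˡ (*-congˡ (eval-derivativeFrom-scale (k + 1#) v p x)) ⟩
    k * (v * a) + x * (v * D)                                      ≈⟨ solve 5 (λ k v a x D → k :* (v :* a) :+ x :* (v :* D) := v :* (k :* a :+ x :* D)) refl k v a x D ⟩
    v * (k * a + x * D)                                            ∎
    where D = eval (derivativeFrom (k + 1#) p) x

  eval-derivative-scale : ∀ v p x → eval (derivative (scale v p)) x ≈ v * eval (derivative p) x
  eval-derivative-scale v []      x = sym (zeroʳ v)
  eval-derivative-scale v (a ∷ p) x = eval-derivativeFrom-scale 1# v p x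

  eval-derivative-negate : ∀ p x → eval (derivative (negate p)) x ≈ - eval (derivative p) x
  eval-derivative-negate p x = trans (eval-derivative-scale (- 1#) p x) (-1*x≈-x _)

  IsZero-derivativeFrom : ∀ k {p} → IsZero p → IsZero (derivativeFrom k p)
  IsZero-derivativeFrom k []            = []
  IsZero-derivativeFrom k (a≈0 ∷ p≈0) = trans (*-congˡ a≈0) (zeroʳ k) ∷ IsZero-derivativeFrom (k + 1#) p≈0

  IsZero-derivative : ∀ {p} → IsZero p → IsZero (derivative p)
  IsZero-derivative []          = []
  IsZero-derivative (_ ∷ p≈0) = IsZero-derivativeFrom 1# p≈0

module OrderedFieldProperties {c ℓ} (R : RealClosedField c ℓ) where
  open RealClosedField R public renaming (_<_ to infix 4 _<_)
  open RCF R public using (fromℕ) renaming (_≤_ to infix 4 _≤_)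
  open IntegerCoefficientSolver commutativeRing public using (Polynomial; solve; _:=_; _:+_; _:-_; _:*_; :-_; con)
  open import Algebra.Properties.AbelianGroup +-abelianGroup public using (⁻¹-involutive; ⁻¹-injective; ε⁻¹≈ε)
  open IsStrictTotalOrder <-isStrictTotalOrder public
    using (compare; _<?_; _≟_; <-respʳ-≈; <-respˡ-≈) renaming (irrefl to <-irrefl; trans to <-trans; asym to <-asym)

  strictTotalOrder : StrictTotalOrder c ℓ ℓ
  strictTotalOrder = record { isStrictTotalOrder = <-isStrictTotalOrder }

  open import Relation.Binary.Properties.StrictTotalOrder strictTotalOrder public
    using () renaming (decTotalOrder to ≤-decTotalOrder; _≤?_ to _≤?_; refl to ≤-refl; trans to ≤-trans)
  open SetoidReasoning setoid

  ⌜_⌝ : ∀ {k} → ℕ → Polynomial k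
  ⌜ zero ⌝  = con (+ 0)
  ⌜ suc n ⌝ = con (+ 1) :+ ⌜ n ⌝

  <⇒≤ : ∀ {x y} → x < y → x ≤ y
  <⇒≤ = inj₁

  <-≤-trans : ∀ {x y z} → x < y → y ≤ z → x < z
  <-≤-trans x<y (inj₁ y<z) = <-trans x<y y<z
  <-≤-trans x<y (inj₂ y≈z) = <-respʳ-≈ y≈z x<y

  ≤-<-trans : ∀ {x y z} → x ≤ y → y < z → x < z
  ≤-<-trans (inj₁ x<y) y<z = <-trans x<y y<z
  ≤-<-trans (inj₂ x≈y) y<z = <-respˡ-≈ (sym x≈y) y<z

  <⇒≉ : ∀ {x y} → x < y → ¬ x ≈ y
  <⇒≉ x<y x≈y = <-irrefl x≈y x<y

  >⇒≉ : ∀ {x y} → y < x → ¬ x ≈ y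
  >⇒≉ y<x x≈y = <-irrefl (sym x≈y) y<x

  ≤⇒≯ : ∀ {x y} → x ≤ y → ¬ y < x
  ≤⇒≯ (inj₁ x<y) = <-asym x<y
  ≤⇒≯ (inj₂ x≈y) = <-irrefl (sym x≈y)

  ≤-<-total : ∀ x y → x ≤ y ⊎ y < x
  ≤-<-total x y with compare x y
  ... | tri< x<y _ _ = inj₁ (inj₁ x<y)
  ... | tri≈ _ x≈y _ = inj₁ (inj₂ x≈y)
  ... | tri> _ _ y<x = inj₂ y<x

  +-monoʳ-< : ∀ z {x y} → x < y → z + x < z + y
  +-monoʳ-< z {x} {y} x<y = <-respˡ-≈ (+-comm x z) (<-respʳ-≈ (+-comm y z) (+-monoˡ-< z x<y))

  +-mono-<-≤ : ∀ {a b x y} → a < b → x ≤ y → a + x < b + y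
  +-mono-<-≤ {x = x} a<b (inj₁ x<y) = <-trans (+-monoˡ-< x a<b) (+-monoʳ-< _ x<y)
  +-mono-<-≤ {x = x} a<b (inj₂ x≈y) = <-respʳ-≈ (+-congˡ x≈y) (+-monoˡ-< x a<b)

  +-mono-≤ : ∀ {a b x y} → a ≤ b → x ≤ y → a + x ≤ b + y
  +-mono-≤ (inj₁ a<b) x≤y        = inj₁ (+-mono-<-≤ a<b x≤y)
  +-mono-≤ (inj₂ a≈b) (inj₁ x<y) = inj₁ (<-respˡ-≈ (+-congʳ (sym a≈b)) (+-monoʳ-< _ x<y))
  +-mono-≤ (inj₂ a≈b) (inj₂ x≈y) = inj₂ (+-cong a≈b x≈y)

  x<y⇒0<y-x : ∀ {x y} → x < y → 0# < y - x
  x<y⇒0<y-x {x} x<y = <-respˡ-≈ (-‿inverseʳ x) (+-monoˡ-< (- x) x<y)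

  0<y-x⇒x<y : ∀ {x y} → 0# < y - x → x < y
  0<y-x⇒x<y {x} {y} 0<y-x = <-respˡ-≈ (+-identityˡ x) (<-respʳ-≈ (solve 2 (λ x y → (y :- x) :+ x := y) refl x y) (+-monoˡ-< x 0<y-x))

  x≤y⇒0≤y-x : ∀ {x y} → x ≤ y → 0# ≤ y - x
  x≤y⇒0≤y-x (inj₁ x<y)       = inj₁ (x<y⇒0<y-x x<y)
  x≤y⇒0≤y-x {x} (inj₂ x≈y) = inj₂ (sym (trans (+-congʳ (sym x≈y)) (-‿inverseʳ x)))

  <-by-difference : ∀ {x y} d → 0# < d → y - x ≈ d → x < y
  <-by-difference d 0<d y-x≈d = 0<y-x⇒x<y (<-respʳ-≈ (sym y-x≈d) 0<d)

  neg-antimono-< : ∀ {x y} → x < y → - y < - x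
  neg-antimono-< {x} {y} x<y = <-by-difference (y - x) (x<y⇒0<y-x x<y) (solve 2 (λ x y → :- x :- :- y := y :- x) refl x y)

  neg-antimono-≤ : ∀ {x y} → x ≤ y → - y ≤ - x
  neg-antimono-≤ (inj₁ x<y) = inj₁ (neg-antimono-< x<y)
  neg-antimono-≤ (inj₂ x≈y) = inj₂ (-‿cong (sym x≈y))

  0<x⇒-x<0 : ∀ {x} → 0# < x → - x < 0#
  0<x⇒-x<0 0<x = <-respʳ-≈ ε⁻¹≈ε (neg-antimono-< 0<x)

  x<y⇒x-y<0 : ∀ {x y} → x < y → x - y < 0#
  x<y⇒x-y<0 {y = y} x<y = <-respʳ-≈ (-‿inverseʳ y) (+-monoˡ-< (- y) x<y)

  x<0⇒0<-x : ∀ {x} → x < 0# → 0# < - x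
  x<0⇒0<-x x<0 = <-respˡ-≈ ε⁻¹≈ε (neg-antimono-< x<0)

  x≤y⇒x-y≤0 : ∀ {x y} → x ≤ y → x - y ≤ 0#
  x≤y⇒x-y≤0 {x} {y} x≤y = ≤-trans (inj₂ (solve 2 (λ x y → x :- y := :- (y :- x)) refl x y)) (≤-trans (neg-antimono-≤ (x≤y⇒0≤y-x x≤y)) (inj₂ ε⁻¹≈ε))

  +-pos-nonNeg : ∀ {x y} → 0# < x → 0# ≤ y → 0# < x + y
  +-pos-nonNeg 0<x 0≤y = <-respˡ-≈ (+-identityʳ 0#) (+-mono-<-≤ 0<x 0≤y)

  +-nonNeg-pos : ∀ {x y} → 0# ≤ x → 0# < y → 0# < x + y
  +-nonNeg-pos {x} {y} 0≤x 0<y = <-respʳ-≈ (+-comm y x) (+-pos-nonNeg 0<y 0≤x)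

  +-nonNeg : ∀ {x y} → 0# ≤ x → 0# ≤ y → 0# ≤ x + y
  +-nonNeg 0≤x 0≤y = ≤-trans (inj₂ (sym (+-identityʳ 0#))) (+-mono-≤ 0≤x 0≤y)

  +-neg-nonPos : ∀ {x y} → x < 0# → y ≤ 0# → x + y < 0#
  +-neg-nonPos x<0 y≤0 = <-respʳ-≈ (+-identityʳ 0#) (+-mono-<-≤ x<0 y≤0)

  +-nonPos-neg : ∀ {x y} → x ≤ 0# → y < 0# → x + y < 0#
  +-nonPos-neg {x} {y} x≤0 y<0 = <-respˡ-≈ (+-comm y x) (+-neg-nonPos y<0 x≤0)

  *-neg-pos : ∀ {x y} → x < 0# → 0# < y → x * y < 0#
  *-neg-pos {x} {y} x<0 0<y =
    <-respˡ-≈ (⁻¹-involutive _) (0<x⇒-x<0 (<-respʳ-≈ (sym (-‿distribˡ-* x y)) (*-pos (x<0⇒0<-x x<0) 0<y)))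
    where open import Algebra.Properties.Ring ring using (-‿distribˡ-*)

  *-pos-neg : ∀ {x y} → 0# < x → y < 0# → x * y < 0#
  *-pos-neg 0<x y<0 = <-respˡ-≈ (*-comm _ _) (*-neg-pos y<0 0<x)

  *-nonNeg : ∀ {x y} → 0# ≤ x → 0# ≤ y → 0# ≤ x * y
  *-nonNeg (inj₁ 0<x) (inj₁ 0<y)         = inj₁ (*-pos 0<x 0<y)
  *-nonNeg {x} (inj₁ 0<x) (inj₂ 0≈y) = inj₂ (sym (trans (*-congˡ (sym 0≈y)) (zeroʳ x)))
  *-nonNeg {y = y} (inj₂ 0≈x) _        = inj₂ (sym (trans (*-congʳ (sym 0≈x)) (zeroˡ y)))

  *-nonNeg-nonPos : ∀ {x y} → 0# ≤ x → y ≤ 0# → x * y ≤ 0#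
  *-nonNeg-nonPos {y = y} (inj₂ 0≈x) _      = inj₂ (trans (*-congʳ (sym 0≈x)) (zeroˡ y))
  *-nonNeg-nonPos {x} (inj₁ 0<x) (inj₂ y≈0) = inj₂ (trans (*-congˡ y≈0) (zeroʳ x))
  *-nonNeg-nonPos (inj₁ 0<x) (inj₁ y<0)     = inj₁ (*-pos-neg 0<x y<0)

  pos∧*-pos⇒pos : ∀ {a b} → 0# < a → 0# < a * b → 0# < b
  pos∧*-pos⇒pos {a} {b} 0<a 0<ab with compare b 0#
  ... | tri< b<0 _ _ = contradiction (*-pos-neg 0<a b<0) (<-asym 0<ab)
  ... | tri≈ _ b≈0 _ = contradiction (sym (trans (*-congˡ b≈0) (zeroʳ a))) (<⇒≉ 0<ab)
  ... | tri> _ _ 0<b = 0<b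

  neg∧*-pos⇒neg : ∀ {a b} → a < 0# → 0# < a * b → b < 0#
  neg∧*-pos⇒neg {a} {b} a<0 0<ab with compare b 0#
  ... | tri< b<0 _ _ = b<0
  ... | tri≈ _ b≈0 _ = contradiction (sym (trans (*-congˡ b≈0) (zeroʳ a))) (<⇒≉ 0<ab)
  ... | tri> _ _ 0<b = contradiction (*-neg-pos a<0 0<b) (<-asym 0<ab)

  pos∧*-neg⇒neg : ∀ {a b} → 0# < a → a * b < 0# → b < 0#
  pos∧*-neg⇒neg {a} {b} 0<a ab<0 with compare b 0#
  ... | tri< b<0 _ _ = b<0
  ... | tri≈ _ b≈0 _ = contradiction (trans (*-congˡ b≈0) (zeroʳ a)) (<⇒≉ ab<0)
  ... | tri> _ _ 0<b = contradiction (*-pos 0<a 0<b) (<-asym ab<0)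

  0<2 : 0# < 1# + 1#
  0<2 = <-trans 0<1 (<-respˡ-≈ (+-identityʳ 1#) (+-monoʳ-< 1# 0<1))

  0<4 : 0# < 1# + 1# + 1# + 1#
  0<4 = +-pos-nonNeg (+-pos-nonNeg 0<2 (<⇒≤ 0<1)) (<⇒≤ 0<1)

  0≤fromℕ : ∀ n → 0# ≤ fromℕ n
  0≤fromℕ zero    = ≤-refl
  0≤fromℕ (suc n) = inj₁ (+-pos-nonNeg 0<1 (0≤fromℕ n))

  0<fromℕ-suc : ∀ n → 0# < fromℕ (suc n)
  0<fromℕ-suc n = +-pos-nonNeg 0<1 (0≤fromℕ n)

  fromℕ-+ : ∀ m n → fromℕ (m ℕ.+ n) ≈ fromℕ m + fromℕ n
  fromℕ-+ zero    n = sym (+-identityˡ _)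
  fromℕ-+ (suc m) n = trans (+-congˡ (fromℕ-+ m n)) (sym (+-assoc _ _ _))

  fromℕ-double : ∀ m → fromℕ (2 ℕ.* m) ≈ fromℕ m + fromℕ m
  fromℕ-double m = trans (fromℕ-+ m (m ℕ.+ 0)) (+-congˡ (reflexive (≡.cong fromℕ (ℕ.+-identityʳ m))))

  x≉0⇒x*y≈0⇒y≈0 : ∀ {x y} → ¬ x ≈ 0# → x * y ≈ 0# → y ≈ 0#
  x≉0⇒x*y≈0⇒y≈0 {x} {y} x≉0 xy≈0 with inverse x x≉0
  ... | x⁻¹ , xx⁻¹≈1 = begin
    y               ≈⟨ *-identityˡ y ⟨
    1# * y          ≈⟨ *-congʳ xx⁻¹≈1 ⟨
    (x * x⁻¹) * y   ≈⟨ solve 3 (λ x i y → (x :* i) :* y := i :* (x :* y)) refl x x⁻¹ y ⟩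
    x⁻¹ * (x * y)   ≈⟨ *-congˡ xy≈0 ⟩
    x⁻¹ * 0#        ≈⟨ zeroʳ x⁻¹ ⟩
    0#              ∎

  x*y≈0⇒x≈0⊎y≈0 : ∀ {x y} → x * y ≈ 0# → x ≈ 0# ⊎ y ≈ 0#
  x*y≈0⇒x≈0⊎y≈0 {x} xy≈0 with x ≟ 0#
  ... | yes x≈0 = inj₁ x≈0
  ... | no x≉0  = inj₂ (x≉0⇒x*y≈0⇒y≈0 x≉0 xy≈0)

  x<y⇒y-x≉0 : ∀ {x y} → x < y → ¬ y - x ≈ 0#
  x<y⇒y-x≉0 x<y = >⇒≉ (x<y⇒0<y-x x<y)

  x-y≈0⇒x≈y : ∀ {x y} → x - y ≈ 0# → x ≈ y
  x-y≈0⇒x≈y {x} {y} x-y≈0 = trans (solve 2 (λ x y → x := (x :- y) :+ y) refl x y) (trans (+-congʳ x-y≈0) (+-identityˡ y))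

  two≉0 : ¬ (1# + 1#) ≈ 0#
  two≉0 = >⇒≉ 0<2

  ½ : Carrier
  ½ = proj₁ (inverse (1# + 1#) two≉0)

  2*½≈1 : (1# + 1#) * ½ ≈ 1#
  2*½≈1 = proj₂ (inverse (1# + 1#) two≉0)

  ½+½≈1 : ½ + ½ ≈ 1#
  ½+½≈1 = trans (solve 1 (λ h → h :+ h := (con (+ 1) :+ con (+ 1)) :* h) refl ½) 2*½≈1

  0<½ : 0# < ½
  0<½ = pos∧*-pos⇒pos 0<2 (<-respʳ-≈ (sym 2*½≈1) 0<1)

  ½<1 : ½ < 1#
  ½<1 = <-by-difference ½ 0<½ (trans (+-congʳ (sym ½+½≈1)) (solve 1 (λ h → (h :+ h) :- h := h) refl ½))

  midpoint : Carrier → Carrier → Carrier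
  midpoint x y = (x + y) * ½

  midpoint-between : ∀ {x y} → x < y → x < midpoint x y × midpoint x y < y
  midpoint-between {x} {y} x<y = <-by-difference ((y - x) * ½) d>0 (lower x y) , <-by-difference ((y - x) * ½) d>0 (upper x y)
    where
    d>0 : 0# < (y - x) * ½
    d>0 = *-pos (x<y⇒0<y-x x<y) 0<½
    lower : ∀ x y → (x + y) * ½ - x ≈ (y - x) * ½
    lower x y = begin
      (x + y) * ½ - x                 ≈⟨ +-congˡ (-‿cong (trans (*-congˡ 2*½≈1) (*-identityʳ x))) ⟨
      (x + y) * ½ - x * ((1# + 1#) * ½) ≈⟨ solve 3 (λ x y h → (x :+ y) :* h :- x :* ((con (+ 1) :+ con (+ 1)) :* h) := (y :- x) :* h) refl x y ½ ⟩
      (y - x) * ½                       ∎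
    upper : ∀ x y → y - (x + y) * ½ ≈ (y - x) * ½
    upper x y = begin
      y - (x + y) * ½                   ≈⟨ +-congʳ (trans (*-congˡ 2*½≈1) (*-identityʳ y)) ⟨
      y * ((1# + 1#) * ½) - (x + y) * ½ ≈⟨ solve 3 (λ x y h → y :* ((con (+ 1) :+ con (+ 1)) :* h) :- (x :+ y) :* h := (y :- x) :* h) refl x y ½ ⟩
      (y - x) * ½                       ∎

module DerivativeSign {c ℓ} (R : RealClosedField c ℓ) where
  open OrderedFieldProperties R
  open PolynomialArithmetic commutativeRing
  open SetoidReasoning setoid

  ivt-↑ : ∀ p v {a b} → a < b → eval p a < v → v < eval p b → ∃ λ z → a < z × z < b × eval p z ≈ v
  ivt-↑ p v {a} {b} a<b pa<v v<pb =
    let z , a<z , z<b , qz≈0 = ivt q a b a<b qa<0 0<qb in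
    z , a<z , z<b , x-y≈0⇒x≈y (trans (sym (eval-addConst (- v) p z)) qz≈0)
    where
    q : Poly
    q = addConst (- v) p
    qa<0 : eval q a < 0#
    qa<0 = <-respˡ-≈ (sym (eval-addConst (- v) p a)) (x<y⇒x-y<0 pa<v)
    0<qb : 0# < eval q b
    0<qb = <-respʳ-≈ (sym (eval-addConst (- v) p b)) (x<y⇒0<y-x v<pb)

  ivt-↓ : ∀ p v {a b} → a < b → v < eval p a → eval p b < v → ∃ λ z → a < z × z < b × eval p z ≈ v
  ivt-↓ p v {a} {b} a<b v<pa pb<v =
    let z , a<z , z<b , -pz≈-v = ivt-↑ (negate p) (- v) a<b -pa<-v -v<-pb in
    z , a<z , z<b , ⁻¹-injective (trans (sym (eval-negate p z)) -pz≈-v)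
    where
    -pa<-v : eval (negate p) a < - v
    -pa<-v = <-respˡ-≈ (sym (eval-negate p a)) (neg-antimono-< v<pa)
    -v<-pb : - v < eval (negate p) b
    -v<-pb = <-respʳ-≈ (sym (eval-negate p b)) (neg-antimono-< pb<v)

  polynomial-ivt-↑ : ∀ {f} → IsPolynomial f → ∀ {a b} → a < b → f a < 0# → 0# < f b → ∃ λ z → a < z × z < b × f z ≈ 0#
  polynomial-ivt-↑ (p , p≈f) a<b fa<0 0<fb =
    let z , a<z , z<b , pz≈0 = ivt-↑ p 0# a<b (<-respˡ-≈ (sym (p≈f _)) fa<0) (<-respʳ-≈ (sym (p≈f _)) 0<fb) in
    z , a<z , z<b , trans (sym (p≈f z)) pz≈0

  polynomial-ivt-↓ : ∀ {f} → IsPolynomial f → ∀ {a b} → a < b → 0# < f a → f b < 0# → ∃ λ z → a < z × z < b × f z ≈ 0#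
  polynomial-ivt-↓ (p , p≈f) a<b 0<fa fb<0 =
    let z , a<z , z<b , pz≈0 = ivt-↓ p 0# a<b (<-respʳ-≈ (sym (p≈f _)) 0<fa) (<-respˡ-≈ (sym (p≈f _)) fb<0) in
    z , a<z , z<b , trans (sym (p≈f z)) pz≈0

  IsZero-derivativeFrom⁻ : ∀ {k} p → 0# < k → IsZero (derivativeFrom k p) → IsZero p
  IsZero-derivativeFrom⁻ []      0<k []            = []
  IsZero-derivativeFrom⁻ (a ∷ p) 0<k (ka≈0 ∷ p′≈0) =
    x≉0⇒x*y≈0⇒y≈0 (>⇒≉ 0<k) ka≈0 ∷ IsZero-derivativeFrom⁻ p (+-pos-nonNeg 0<k (<⇒≤ 0<1)) p′≈0

  IsZero-derivative⇒constant : ∀ a p → IsZero (derivative (a ∷ p)) → ∀ x → eval (a ∷ p) x ≈ a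
  IsZero-derivative⇒constant a p p′≈0 x =
    trans (+-congˡ (trans (*-congˡ (IsZero⇒eval≈0 (IsZero-derivativeFrom⁻ p 0<1 p′≈0) x)) (zeroʳ x))) (+-identityʳ a)

  zeros⇒IsZero : ∀ rs p → AllPairs _<_ rs → All (λ r → eval p r ≈ 0#) rs → length p ℕ.≤ length rs → IsZero p
  zeros⇒IsZero []       []      _                  _               _           = []
  zeros⇒IsZero (r ∷ rs) []      _                  _               _           = []
  zeros⇒IsZero (r ∷ rs) (a ∷ p) (r<rs ∷ rs-sorted) (pr≈0 ∷ prs≈0) (s≤s p≤rs) =
    quotient-root⇒IsZero r (a ∷ p) q≈0 pr≈0
    where
    q = quotient r (a ∷ p)
    q-zero : ∀ {r′} → r < r′ → eval (a ∷ p) r′ ≈ 0# → eval q r′ ≈ 0#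
    q-zero {r′} r<r′ pr′≈0 = x≉0⇒x*y≈0⇒y≈0 (x<y⇒y-x≉0 r<r′) (trans (sym (remainder-theorem-root (a ∷ p) r′ pr≈0)) pr′≈0)
    q≈0 : IsZero q
    q≈0 = zeros⇒IsZero rs q rs-sorted (All.zipWith (uncurry q-zero) (r<rs , prs≈0))
                       (≡.subst (ℕ._≤ length rs) (≡.sym (length-quotient r (a ∷ p))) p≤rs)

  -- With g = (X − s)(X − y) h, the derivative is (s − y) h(s) at s and (y − s) h(y) at y, so h changes sign on (s, y).
  zero-between : ∀ g {s y} → s < y → eval g s ≈ 0# → eval g y ≈ 0# →
                 0# < eval (derivative g) s → 0# < eval (derivative g) y →
                 ∃ λ z → s < z × z < y × eval g z ≈ 0#
  zero-between g {s} {y} s<y gs≈0 gy≈0 0<g′s 0<g′y =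
    let z , s<z , z<y , hz≈0 = ivt-↑ h 0# s<y hs<0 0<hy in
    z , s<z , z<y , g≈0 z (trans (q≈[X-y]h z) (trans (*-congˡ hz≈0) (zeroʳ _)))
    where
    q = quotient s g
    h = quotient y q
    qy≈0 : eval q y ≈ 0#
    qy≈0 = x≉0⇒x*y≈0⇒y≈0 (x<y⇒y-x≉0 s<y) (trans (sym (remainder-theorem-root g y gs≈0)) gy≈0)
    q≈[X-y]h : ∀ x → eval q x ≈ (x - y) * eval h x
    q≈[X-y]h x = remainder-theorem-root q x qy≈0
    g≈0 : ∀ x → eval q x ≈ 0# → eval g x ≈ 0#
    g≈0 x qx≈0 = trans (remainder-theorem-root g x gs≈0) (trans (*-congˡ qx≈0) (zeroʳ _))
    hs<0 : eval h s < 0#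
    hs<0 = neg∧*-pos⇒neg (x<y⇒x-y<0 s<y) (<-respʳ-≈ (trans (derivative≈quotient s g) (q≈[X-y]h s)) 0<g′s)
    g′y≈[y-s]hy : eval (derivative g) y ≈ (y - s) * eval h y
    g′y≈[y-s]hy = begin
      eval (derivative g) y                                              ≈⟨ derivative≈quotient y g ⟩
      eval (quotient y g) y                                              ≈⟨ remainder-theorem s (quotient y g) y ⟩
      (y - s) * eval (quotient s (quotient y g)) y + eval (quotient y g) s ≈⟨ +-cong (*-congˡ (eval-resp-≋ (quotient-comm y s g) y)) (quotient-sym y s g) ⟩
      (y - s) * eval h y + eval q y                                      ≈⟨ +-congˡ qy≈0 ⟩
      (y - s) * eval h y + 0#                                            ≈⟨ +-identityʳ _ ⟩
      (y - s) * eval h y                                                 ∎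
    0<hy : 0# < eval h y
    0<hy = pos∧*-pos⇒pos (x<y⇒0<y-x s<y) (<-respʳ-≈ g′y≈[y-s]hy 0<g′y)

  DerivativePositiveOn : Poly → Carrier → Carrier → Set (c ⊔ ℓ)
  DerivativePositiveOn p s t = ∀ z → s ≤ z → z ≤ t → 0# < eval (derivative p) z

  record ZeroChain (g : Poly) (s t : Carrier) (k : ℕ) : Set (c ⊔ ℓ) where
    constructor chain
    field
      zs        : List Carrier
      length-zs : length zs ≡ suc k
      sorted    : AllPairs _<_ zs
      zeros     : All (λ z → s < z × z ≤ t × eval g z ≈ 0#) zs

  -- Repeating zero-between below the least zero found so far yields arbitrarily many zeros.
  zero-chain : ∀ g {s t} → s < t → eval g s ≈ 0# → eval g t ≈ 0# → DerivativePositiveOn g s t → ∀ k → ZeroChain g s t k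
  zero-chain g s<t gs≈0 gt≈0 g′>0 zero    = chain (_ ∷ []) ≡.refl ([] ∷ []) ((s<t , ≤-refl , gt≈0) ∷ [])
  zero-chain g s<t gs≈0 gt≈0 g′>0 (suc k) with zero-chain g s<t gs≈0 gt≈0 g′>0 k
  ... | chain (y ∷ ys) len (y<ys ∷ sorted) ((s<y , y≤t , gy≈0) ∷ zeros) =
    let z , s<z , z<y , gz≈0 = zero-between g s<y gs≈0 gy≈0 (g′>0 _ ≤-refl (<⇒≤ s<t)) (g′>0 _ (<⇒≤ s<y) y≤t) in
    chain (z ∷ y ∷ ys) (≡.cong suc len) ((z<y ∷ All.map (<-trans z<y) y<ys) ∷ y<ys ∷ sorted)
          ((s<z , <⇒≤ (<-≤-trans z<y y≤t) , gz≈0) ∷ (s<y , y≤t , gy≈0) ∷ zeros)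

  derivative-pos⇒¬two-zeros : ∀ g {s t} → s < t → eval g s ≈ 0# → eval g t ≈ 0# → ¬ DerivativePositiveOn g s t
  derivative-pos⇒¬two-zeros g {s} s<t gs≈0 gt≈0 g′>0 = <⇒≉ (g′>0 s ≤-refl (<⇒≤ s<t)) (sym (IsZero⇒eval≈0 (IsZero-derivative g≈0) s))
    where
    open ZeroChain (zero-chain g s<t gs≈0 gt≈0 g′>0 (length g))
    g≈0 : IsZero g
    g≈0 = zeros⇒IsZero zs g sorted (All.map (proj₂ ∘ proj₂) zeros) (≡.subst (length g ℕ.≤_) (≡.sym length-zs) (ℕ.n≤1+n _))

  -- g x = (t − s)(p x − p s) − (p t − p s)(x − s) vanishes at s and t, and g′ > 0 on [s, t] if p t ≤ p s.
  derivative-pos⇒increasing : ∀ p {s t} → s < t → DerivativePositiveOn p s t → eval p s < eval p t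
  derivative-pos⇒increasing p {s} {t} s<t p′>0 with ≤-<-total (eval p t) (eval p s)
  ... | inj₂ ps<pt = ps<pt
  ... | inj₁ pt≤ps = contradiction g′>0 (derivative-pos⇒¬two-zeros g s<t gs≈0 gt≈0)
    where
    ps = eval p s
    pt = eval p t
    D = pt - ps
    p-ps = scale (t - s) (addConst (- ps) p)
    line = D * s ∷ - D ∷ []
    g = p-ps ⊕ line
    eval-g : ∀ x → eval g x ≈ (t - s) * (eval p x - ps) + (D * s + x * (- D + x * 0#))
    eval-g x = trans (eval-⊕ p-ps line x) (+-congʳ (trans (eval-scale (t - s) (addConst (- ps) p) x) (*-congˡ (eval-addConst (- ps) p x))))
    gs≈0 : eval g s ≈ 0#
    gs≈0 = trans (eval-g s) (solve 4 (λ s t ps D → (t :- s) :* (ps :- ps) :+ (D :* s :+ s :* (:- D :+ s :* con (+ 0))) := con (+ 0)) refl s t ps D)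
    gt≈0 : eval g t ≈ 0#
    gt≈0 = trans (eval-g t) (solve 4 (λ s t ps pt → (t :- s) :* (pt :- ps) :+ ((pt :- ps) :* s :+ t :* (:- (pt :- ps) :+ t :* con (+ 0))) := con (+ 0)) refl s t ps pt)
    0≤-D : 0# ≤ - D
    0≤-D = ≤-trans (x≤y⇒0≤y-x pt≤ps) (inj₂ (solve 2 (λ ps pt → ps :- pt := :- (pt :- ps)) refl ps pt))
    g′≈ : ∀ z → eval (derivative g) z ≈ (t - s) * eval (derivative p) z + - D
    g′≈ z = begin
      eval (derivative g) z                                 ≈⟨ eval-derivative-⊕ p-ps line z ⟩
      eval (derivative p-ps) z + (1# * - D + z * 0#)        ≈⟨ +-cong (eval-derivative-scale (t - s) (addConst (- ps) p) z) (solve 2 (λ D z → con (+ 1) :* (:- D) :+ z :* con (+ 0) := :- D) refl D z) ⟩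
      (t - s) * eval (derivative (addConst (- ps) p)) z + - D ≈⟨ +-congʳ (*-congˡ (reflexive (≡.cong (λ q → eval q z) (derivative-addConst (- ps) p)))) ⟩
      (t - s) * eval (derivative p) z + - D                 ∎
    g′>0 : DerivativePositiveOn g s t
    g′>0 z s≤z z≤t = <-respʳ-≈ (sym (g′≈ z)) (+-pos-nonNeg (*-pos (x<y⇒0<y-x s<t) (p′>0 z s≤z z≤t)) 0≤-D)

  DerivativePositiveIn : Poly → Carrier → Carrier → Set (c ⊔ ℓ)
  DerivativePositiveIn p s t = ∀ z → s < z → z < t → 0# < eval (derivative p) z

  -- p is increasing on closed subintervals of (s, t); the IVT rules out a drop at either end.
  derivative-pos-inside⇒increasing : ∀ p {s t} → s < t → DerivativePositiveIn p s t → eval p s < eval p t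
  derivative-pos-inside⇒increasing p {s} {t} s<t p′>0 = ≤-<-trans (left s<x x<t) (<-≤-trans (inner s<x x<m m<t) (right s<m m<t))
    where
    m x : Carrier
    m = midpoint s t
    x = midpoint s m
    s<m : s < m
    s<m = proj₁ (midpoint-between s<t)
    m<t : m < t
    m<t = proj₂ (midpoint-between s<t)
    s<x : s < x
    s<x = proj₁ (midpoint-between s<m)
    x<m : x < m
    x<m = proj₂ (midpoint-between s<m)
    x<t : x < t
    x<t = <-trans x<m m<t
    inner : ∀ {a b} → s < a → a < b → b < t → eval p a < eval p b
    inner s<a a<b b<t = derivative-pos⇒increasing p a<b λ z a≤z z≤b → p′>0 z (<-≤-trans s<a a≤z) (≤-<-trans z≤b b<t)
    left : ∀ {y} → s < y → y < t → eval p s ≤ eval p y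
    left {y} s<y y<t with ≤-<-total (eval p s) (eval p y)
    ... | inj₁ ps≤py = ps≤py
    ... | inj₂ py<ps =
      let s<a , a<y = midpoint-between s<y
          z , s<z , z<a , pz≈py = ivt-↓ p (eval p y) s<a py<ps (inner s<a a<y y<t)
      in contradiction pz≈py (<⇒≉ (inner s<z (<-trans z<a a<y) y<t))
    right : ∀ {y} → s < y → y < t → eval p y ≤ eval p t
    right {y} s<y y<t with ≤-<-total (eval p y) (eval p t)
    ... | inj₁ py≤pt = py≤pt
    ... | inj₂ pt<py =
      let y<b , b<t = midpoint-between y<t
          z , b<z , z<t , pz≈py = ivt-↓ p (eval p y) b<t (inner s<y y<b b<t) pt<py
      in contradiction pz≈py (>⇒≉ (inner s<y (<-trans y<b b<z) z<t))

module ZeroIsolation {c ℓ} (R : RealClosedField c ℓ) where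
  open OrderedFieldProperties R
  open PolynomialArithmetic commutativeRing
  open DerivativeSign R
  open RCF R using (IsMinZero)
  open import Data.List.Membership.Setoid setoid using (_∈_)
  open import Data.List.Membership.Propositional using (find) renaming (_∈_ to _∈ₚ_)
  open import Data.List.Relation.Unary.All.Properties using (all-filter)
  open import Data.List.Membership.Propositional.Properties using (∈-filter⁺; ∈-filter⁻)
  open import Data.List.Extrema (DecTotalOrder.totalOrder ≤-decTotalOrder) using (min; max; argmin-all; argmax-all; min≤⊤; min≤xs; ⊥≤max; xs≤max)

  DerivativeNonZeroIn : Poly → Carrier → Carrier → Set (c ⊔ ℓ)
  DerivativeNonZeroIn p u v = ∀ w → u < w → w < v → ¬ eval (derivative p) w ≈ 0#

  StrictlyIncreasingOn : Poly → Carrier → Carrier → Set (c ⊔ ℓ)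
  StrictlyIncreasingOn p u v = ∀ {x y} → u ≤ x → x < y → y ≤ v → eval p x < eval p y

  StrictlyDecreasingOn : Poly → Carrier → Carrier → Set (c ⊔ ℓ)
  StrictlyDecreasingOn p u v = ∀ {x y} → u ≤ x → x < y → y ≤ v → eval p y < eval p x

  -- A sign change of p′ inside (u, v) would give it a zero there, by the IVT.
  derivative-nonZero∧pos⇒increasing : ∀ p {u v m} → u < m → m < v → DerivativeNonZeroIn p u v →
                                       0# < eval (derivative p) m → StrictlyIncreasingOn p u v
  derivative-nonZero∧pos⇒increasing p {u} {v} {m} u<m m<v p′≉0 0<p′m u≤x x<y y≤v =
    derivative-pos-inside⇒increasing p x<y λ z x<z z<y → p′>0 z (≤-<-trans u≤x x<z) (<-≤-trans z<y y≤v)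
    where
    p′ = derivative p
    p′>0 : ∀ w → u < w → w < v → 0# < eval p′ w
    p′>0 w u<w w<v with compare (eval p′ w) 0# | compare w m
    ... | tri> _ _ 0<p′w | _           = 0<p′w
    ... | tri≈ _ p′w≈0 _ | _           = contradiction p′w≈0 (p′≉0 w u<w w<v)
    ... | tri< p′w<0 _ _ | tri< w<m _ _ =
      let z , w<z , z<m , p′z≈0 = ivt-↑ p′ 0# w<m p′w<0 0<p′m in contradiction p′z≈0 (p′≉0 z (<-trans u<w w<z) (<-trans z<m m<v))
    ... | tri< p′w<0 _ _ | tri≈ _ w≈m _ = contradiction (<-respʳ-≈ (eval-cong p′ (sym w≈m)) 0<p′m) (<-asym p′w<0)
    ... | tri< p′w<0 _ _ | tri> _ _ m<w =
      let z , m<z , z<w , p′z≈0 = ivt-↓ p′ 0# m<w 0<p′m p′w<0 in contradiction p′z≈0 (p′≉0 z (<-trans u<m m<z) (<-trans z<w w<v))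

  derivative-nonZero⇒monotone : ∀ p {u v} → u < v → DerivativeNonZeroIn p u v →
                                StrictlyIncreasingOn p u v ⊎ StrictlyDecreasingOn p u v
  derivative-nonZero⇒monotone p {u} {v} u<v p′≉0 = by-sign (compare (eval (derivative p) m) 0#)
    where
    m : Carrier
    m = midpoint u v
    u<m : u < m
    u<m = proj₁ (midpoint-between u<v)
    m<v : m < v
    m<v = proj₂ (midpoint-between u<v)
    -p′≉0 : DerivativeNonZeroIn (negate p) u v
    -p′≉0 w u<w w<v -p′w≈0 = p′≉0 w u<w w<v (⁻¹-injective (trans (sym (eval-derivative-negate p w)) (trans -p′w≈0 (sym ε⁻¹≈ε))))
    negate-increasing⇒decreasing : StrictlyIncreasingOn (negate p) u v → StrictlyDecreasingOn p u v
    negate-increasing⇒decreasing increasing u≤x x<y y≤v =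
      <-respˡ-≈ (⁻¹-involutive _) (<-respʳ-≈ (⁻¹-involutive _)
        (neg-antimono-< (<-respˡ-≈ (eval-negate p _) (<-respʳ-≈ (eval-negate p _) (increasing u≤x x<y y≤v)))))
    by-sign : Tri (eval (derivative p) m < 0#) (eval (derivative p) m ≈ 0#) (0# < eval (derivative p) m) →
              StrictlyIncreasingOn p u v ⊎ StrictlyDecreasingOn p u v
    by-sign (tri> _ _ 0<p′m) = inj₁ (derivative-nonZero∧pos⇒increasing p u<m m<v p′≉0 0<p′m)
    by-sign (tri≈ _ p′m≈0 _) = contradiction p′m≈0 (p′≉0 m u<m m<v)
    by-sign (tri< p′m<0 _ _) = inj₂ (negate-increasing⇒decreasing (derivative-nonZero∧pos⇒increasing (negate p) u<m m<v -p′≉0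
                                 (<-respʳ-≈ (sym (eval-derivative-negate p m)) (x<0⇒0<-x p′m<0))))

  increasing⇒injective : ∀ {p u v x y} → StrictlyIncreasingOn p u v → u ≤ x → x ≤ v → u ≤ y → y ≤ v →
                         eval p x ≈ eval p y → x ≈ y
  increasing⇒injective {x = x} {y} increasing u≤x x≤v u≤y y≤v px≈py with compare x y
  ... | tri< x<y _ _ = contradiction px≈py (<⇒≉ (increasing u≤x x<y y≤v))
  ... | tri≈ _ x≈y _ = x≈y
  ... | tri> _ _ y<x = contradiction px≈py (>⇒≉ (increasing u≤y y<x x≤v))

  ZeroList : Poly → Carrier → Carrier → List Carrier → Set (c ⊔ ℓ)
  ZeroList p a b zs = ∀ t → a ≤ t → t ≤ b → eval p t ≈ 0# → t ∈ zs

  upCrossing : Poly → Carrier → Carrier → List Carrier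
  upCrossing p u v with u <? v | eval p u <? 0# | 0# <? eval p v
  ... | yes u<v | yes pu<0 | yes 0<pv = proj₁ (ivt p u v u<v pu<0 0<pv) ∷ []
  ... | _       | _        | _        = []

  increasing⇒zero∈upCrossing : ∀ p {u v t} → StrictlyIncreasingOn p u v → u < t → t < v → eval p t ≈ 0# →
                               t ∈ upCrossing p u v
  increasing⇒zero∈upCrossing p {u} {v} {t} increasing u<t t<v pt≈0 with u <? v | eval p u <? 0# | 0# <? eval p v
  ... | yes u<v | yes pu<0 | yes 0<pv = let _ , u<z , z<v , pz≈0 = ivt p u v u<v pu<0 0<pv in
    here (increasing⇒injective {p} increasing (<⇒≤ u<t) (<⇒≤ t<v) (<⇒≤ u<z) (<⇒≤ z<v) (trans pt≈0 (sym pz≈0)))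
  ... | no u≮v  | _        | _        = contradiction (<-trans u<t t<v) u≮v
  ... | yes _   | no pu≮0  | _        = contradiction (<-respʳ-≈ pt≈0 (increasing ≤-refl u<t (<⇒≤ t<v))) pu≮0
  ... | yes _   | yes _    | no 0≮pv  = contradiction (<-respˡ-≈ pt≈0 (increasing (<⇒≤ u<t) t<v ≤-refl)) 0≮pv

  crossing : Poly → Carrier → Carrier → List Carrier
  crossing p u v = upCrossing p u v ++ upCrossing (negate p) u v

  crossings : Poly → List Carrier → List Carrier
  crossings p B = concat (cartesianProductWith (crossing p) B B)

  ∈-crossings : ∀ p {B u v t} → u ∈ₚ B → v ∈ₚ B → t ∈ crossing p u v → t ∈ crossings p B
  ∈-crossings p u∈B v∈B t∈crossing = Any.concat⁺ (Any.cartesianProductWith⁺ (crossing p) (λ { ≡.refl ≡.refl → t∈crossing }) u∈B v∈B)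

  monotone⇒zero∈crossing : ∀ p {u v t} → StrictlyIncreasingOn p u v ⊎ StrictlyDecreasingOn p u v →
                           u < t → t < v → eval p t ≈ 0# → t ∈ crossing p u v
  monotone⇒zero∈crossing p (inj₁ increasing) u<t t<v pt≈0 = Any.++⁺ˡ (increasing⇒zero∈upCrossing p increasing u<t t<v pt≈0)
  monotone⇒zero∈crossing p {t = t} (inj₂ decreasing) u<t t<v pt≈0 =
    Any.++⁺ʳ (upCrossing p _ _) (increasing⇒zero∈upCrossing (negate p) -p-increasing u<t t<v -pt≈0)
    where
    -p-increasing : StrictlyIncreasingOn (negate p) _ _
    -p-increasing u≤x x<y y≤v = <-respˡ-≈ (sym (eval-negate p _)) (<-respʳ-≈ (sym (eval-negate p _)) (neg-antimono-< (decreasing u≤x x<y y≤v)))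
    -pt≈0 : eval (negate p) t ≈ 0#
    -pt≈0 = trans (eval-negate p t) (trans (-‿cong pt≈0) ε⁻¹≈ε)

  -- Between consecutive points among a, b and the zeros of p′, p is strictly monotone.
  zeroList-step : ∀ p {a b zs′} → ZeroList (derivative p) a b zs′ →
                  ZeroList p a b ((a ∷ b ∷ zs′) ++ crossings p (a ∷ b ∷ zs′))
  zeroList-step p {a} {b} {zs′} zs′-complete t a≤t t≤b pt≈0 with any? (t ≟_) (a ∷ b ∷ zs′)
  ... | yes t∈B = Any.++⁺ˡ t∈B
  ... | no t∉B  = Any.++⁺ʳ (a ∷ b ∷ zs′) (∈-crossings p u∈B v∈B (monotone⇒zero∈crossing p monotone u<t t<v pt≈0))
    where
    a<t : a < t
    a<t = [ id , (λ a≈t → contradiction (here (sym a≈t)) t∉B) ]′ a≤t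
    t<b : t < b
    t<b = [ id , (λ t≈b → contradiction (there (here t≈b)) t∉B) ]′ t≤b
    below = filter (_<? t) zs′
    above = filter (t <?_) zs′
    u = max a below
    v = min b above
    u<t∧u∈B : u < t × u ∈ₚ a ∷ b ∷ zs′
    u<t∧u∈B = argmax-all id {P = λ x → x < t × x ∈ₚ a ∷ b ∷ zs′} {xs = below} (a<t , here ≡.refl) (All.tabulate λ x∈below →
                let x∈zs′ , x<t = ∈-filter⁻ (_<? t) x∈below in x<t , there (there x∈zs′))
    t<v∧v∈B : t < v × v ∈ₚ a ∷ b ∷ zs′
    t<v∧v∈B = argmin-all id {xs = above} {P = λ x → t < x × x ∈ₚ a ∷ b ∷ zs′} (t<b , there (here ≡.refl)) (All.tabulate λ x∈above →
                let x∈zs′ , t<x = ∈-filter⁻ (t <?_) x∈above in t<x , there (there x∈zs′))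
    u<t : u < t
    u<t = proj₁ u<t∧u∈B
    u∈B : u ∈ₚ a ∷ b ∷ zs′
    u∈B = proj₂ u<t∧u∈B
    t<v : t < v
    t<v = proj₁ t<v∧v∈B
    v∈B : v ∈ₚ a ∷ b ∷ zs′
    v∈B = proj₂ t<v∧v∈B
    no-zero : DerivativeNonZeroIn p u v
    no-zero w u<w w<v p′w≈0 with find (zs′-complete w (≤-trans (⊥≤max a below) (<⇒≤ u<w)) (≤-trans (<⇒≤ w<v) (min≤⊤ b above)) p′w≈0)
    ... | x , x∈zs′ , w≈x with compare x t
    ...   | tri< x<t _ _ = ≤⇒≯ (All.lookup (xs≤max a below) (∈-filter⁺ (_<? t) x∈zs′ x<t)) (<-respʳ-≈ w≈x u<w)
    ...   | tri≈ _ x≈t _ = t∉B (there (there (Any.map (λ { ≡.refl → sym x≈t }) x∈zs′)))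
    ...   | tri> _ _ t<x = ≤⇒≯ (All.lookup (min≤xs b above) (∈-filter⁺ (t <?_) x∈zs′ t<x)) (<-respˡ-≈ w≈x w<v)
    monotone : StrictlyIncreasingOn p u v ⊎ StrictlyDecreasingOn p u v
    monotone = derivative-nonZero⇒monotone p (<-trans u<t t<v) no-zero

  isolate-zeros : ∀ n p → length p ℕ.≤ n → ∀ a b → IsZero p ⊎ ∃ (ZeroList p a b)
  isolate-zeros n       []      _          a b = inj₁ []
  isolate-zeros (suc n) (k ∷ p) (s≤s p≤n) a b
    with isolate-zeros n (derivative (k ∷ p)) (≡.subst (ℕ._≤ n) (≡.sym (length-derivativeFrom 1# p)) p≤n) a b
  ... | inj₂ (_ , zs′-complete) = inj₂ (_ , zeroList-step (k ∷ p) zs′-complete)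
  ... | inj₁ p′≈0 with k ≟ 0#
  ...   | yes k≈0 = inj₁ (k≈0 ∷ IsZero-derivativeFrom⁻ p 0<1 p′≈0)
  ...   | no k≉0  = inj₂ ([] , λ t _ _ pt≈0 → contradiction (trans (sym (IsZero-derivative⇒constant k p p′≈0 t)) pt≈0) k≉0)

  least-zero : ∀ {f} → IsPolynomial f → ∀ {a c₀} → a ≤ c₀ → f c₀ ≈ 0# → (∀ y → y < a → ¬ f y ≈ 0#) →
               ∃ λ r → IsMinZero f r × a ≤ r × r ≤ c₀
  least-zero {f} (p , p≈f) {a} {c₀} a≤c₀ fc₀≈0 no-zero-below with isolate-zeros (length p) p ℕ.≤-refl a c₀
  ... | inj₁ p≈0 = contradiction (trans (sym (p≈f (a - 1#))) (IsZero⇒eval≈0 p≈0 _)) (no-zero-below (a - 1#) a-1<a)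
    where a-1<a = <-by-difference 1# 0<1 (solve 1 (λ a → a :- (a :- con (+ 1)) := con (+ 1)) refl a)
  ... | inj₂ (zs , zs-complete) = r , (fr≈0 , r-least) , a≤r , min≤⊤ c₀ candidates
    where
    Candidate : Carrier → Set ℓ
    Candidate x = a ≤ x × x ≤ c₀ × eval p x ≈ 0#
    candidate? : ∀ x → Dec (Candidate x)
    candidate? x = a ≤? x ×-dec x ≤? c₀ ×-dec eval p x ≟ 0#
    candidates = filter candidate? zs
    r = min c₀ candidates
    r-candidate : Candidate r
    r-candidate = argmin-all id (a≤c₀ , ≤-refl , trans (p≈f c₀) fc₀≈0) (all-filter candidate? zs)
    a≤r : a ≤ r
    a≤r = proj₁ r-candidate
    fr≈0 : f r ≈ 0#
    fr≈0 = trans (sym (p≈f r)) (proj₂ (proj₂ r-candidate))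
    ≈-candidate : ∀ {y x} → Candidate y → y ≈ x → Candidate x
    ≈-candidate (a≤y , y≤c₀ , py≈0) y≈x = ≤-trans a≤y (inj₂ y≈x) , ≤-trans (inj₂ (sym y≈x)) y≤c₀ , trans (eval-cong p (sym y≈x)) py≈0
    r-least : ∀ y → f y ≈ 0# → r ≤ y
    r-least y fy≈0 with ≤-<-total a y | ≤-<-total y c₀
    ... | inj₂ y<a | _         = contradiction fy≈0 (no-zero-below y y<a)
    ... | inj₁ _   | inj₂ c₀<y = <⇒≤ (≤-<-trans (min≤⊤ c₀ candidates) c₀<y)
    ... | inj₁ a≤y | inj₁ y≤c₀ =
      let py≈0 = trans (p≈f y) fy≈0
          x , x∈zs , y≈x = find (zs-complete y a≤y y≤c₀ py≈0)
      in ≤-trans (All.lookup (min≤xs c₀ candidates) (∈-filter⁺ candidate? x∈zs (≈-candidate (a≤y , y≤c₀ , py≈0) y≈x))) (inj₂ (sym y≈x))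

module ChebyshevPolynomials {c ℓ} (R : RealClosedField c ℓ) where
  open OrderedFieldProperties R
  open PolynomialArithmetic commutativeRing
  open RCF R using (Ũ)
  open SetoidReasoning setoid

  Ũ-isPolynomial : ∀ k → IsPolynomial (Ũ k)
  Ũ-isPolynomial zero          = constᴾ 0#
  Ũ-isPolynomial (suc zero)    = constᴾ 1#
  Ũ-isPolynomial (suc (suc k)) = (idᴾ +ᴾ idᴾ) *ᴾ Ũ-isPolynomial (suc k) −ᴾ Ũ-isPolynomial k

  Ũ-addition : ∀ j k x → Ũ (suc (j ℕ.+ k)) x ≈ Ũ (suc j) x * Ũ (suc k) x - Ũ j x * Ũ k x
  Ũ-addition zero          k x = solve 2 (λ a b → a := con (+ 1) :* a :- con (+ 0) :* b) refl (Ũ (suc k) x) (Ũ k x)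
  Ũ-addition (suc zero)    k x = solve 3 (λ x a b → (x :+ x) :* a :- b := ((x :+ x) :* con (+ 1) :- con (+ 0)) :* a :- con (+ 1) :* b) refl x (Ũ (suc k) x) (Ũ k x)
  Ũ-addition (suc (suc j)) k x = begin
    (x + x) * Ũ (suc (suc (j ℕ.+ k))) x - Ũ (suc (j ℕ.+ k)) x   ≈⟨ +-cong (*-congˡ (Ũ-addition (suc j) k x)) (-‿cong (Ũ-addition j k x)) ⟩
    (x + x) * (a₁ * b₁ - a₀ * b₀) - (a₀ * b₁ - a₋ * b₀)          ≈⟨ solve 5 (λ x a₀ a₋ b₁ b₀ → (x :+ x) :* (((x :+ x) :* a₀ :- a₋) :* b₁ :- a₀ :* b₀) :- (a₀ :* b₁ :- a₋ :* b₀) := ((x :+ x) :* ((x :+ x) :* a₀ :- a₋) :- a₀) :* b₁ :- ((x :+ x) :* a₀ :- a₋) :* b₀) refl x a₀ a₋ b₁ b₀ ⟩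
    ((x + x) * a₁ - a₀) * b₁ - a₁ * b₀                           ∎
    where a₁ = Ũ (suc (suc j)) x
          a₀ = Ũ (suc j) x
          a₋ = Ũ j x
          b₁ = Ũ (suc k) x
          b₀ = Ũ k x

  Ũ-cassini : ∀ k x → Ũ (suc k) x * Ũ (suc k) x - Ũ (suc (suc k)) x * Ũ k x ≈ 1#
  Ũ-cassini zero    x = solve 1 (λ x → con (+ 1) :* con (+ 1) :- ((x :+ x) :* con (+ 1) :- con (+ 0)) :* con (+ 0) := con (+ 1)) refl x
  Ũ-cassini (suc k) x = trans (solve 3 (λ x b a → ((x :+ x) :* b :- a) :* ((x :+ x) :* b :- a) :- ((x :+ x) :* ((x :+ x) :* b :- a) :- b) :* b := b :* b :- ((x :+ x) :* b :- a) :* a) refl x (Ũ (suc k) x) (Ũ k x)) (Ũ-cassini k x)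

  Ũ-one : ∀ k → Ũ k 1# ≈ fromℕ k
  Ũ-one zero          = refl
  Ũ-one (suc zero)    = sym (+-identityʳ 1#)
  Ũ-one (suc (suc k)) = trans (+-cong (*-congˡ (Ũ-one (suc k))) (-‿cong (Ũ-one k))) (solve 1 (λ n → (con (+ 1) :+ con (+ 1)) :* (con (+ 1) :+ n) :- n := con (+ 1) :+ (con (+ 1) :+ n)) refl (fromℕ k))

  sign : ℕ → Carrier
  sign zero    = 1#
  sign (suc k) = - sign k

  sign-suc-suc : ∀ k → sign (suc (suc k)) ≈ sign k
  sign-suc-suc k = ⁻¹-involutive (sign k)

  sign-double : ∀ m → sign (2 ℕ.* m) ≈ 1#
  sign-double zero    = refl
  sign-double (suc m) = begin
    sign (2 ℕ.* suc m)       ≡⟨ ≡.cong sign (ℕ.*-distribˡ-+ 2 1 m) ⟩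
    sign (suc (suc (2 ℕ.* m))) ≈⟨ sign-suc-suc (2 ℕ.* m) ⟩
    sign (2 ℕ.* m)           ≈⟨ sign-double m ⟩
    1#                       ∎

  sign≉0 : ∀ k → ¬ sign k ≈ 0#
  sign≉0 zero    = >⇒≉ 0<1
  sign≉0 (suc k) -s≈0 = sign≉0 k (⁻¹-injective (trans -s≈0 (sym ε⁻¹≈ε)))

  Ũ-reflect : ∀ k x → Ũ k (- x) ≈ sign (suc k) * Ũ k x
  Ũ-reflect zero          x = sym (zeroʳ _)
  Ũ-reflect (suc zero)    x = solve 0 (con (+ 1) := (:- (:- con (+ 1))) :* con (+ 1)) refl
  Ũ-reflect (suc (suc k)) x = begin
    (- x + - x) * Ũ (suc k) (- x) - Ũ k (- x)                          ≈⟨ +-cong (*-congˡ (Ũ-reflect (suc k) x)) (-‿cong (Ũ-reflect k x)) ⟩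
    (- x + - x) * (- s * Ũ (suc k) x) - s * Ũ k x                     ≈⟨ solve 4 (λ x s a b → (:- x :+ :- x) :* (:- s :* a) :- s :* b := (:- (:- s)) :* ((x :+ x) :* a :- b)) refl x s (Ũ (suc k) x) (Ũ k x) ⟩
    - - s * ((x + x) * Ũ (suc k) x - Ũ k x)                            ∎
    where s = sign (suc k)

  Ũ-growth : ∀ {x} → 1# ≤ x → ∀ k → 1# ≤ Ũ (suc k) x - Ũ k x × 1# ≤ Ũ (suc k) x
  Ũ-growth {x} 1≤x zero    = inj₂ (sym (trans (+-congˡ ε⁻¹≈ε) (+-identityʳ 1#))) , ≤-refl
  Ũ-growth {x} 1≤x (suc k) = 1≤d′ , ≤-trans 1≤u+d′ (inj₂ (solve 2 (λ a b → b :+ (a :- b) := a) refl (Ũ (suc (suc k)) x) u))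
    where
    u = Ũ (suc k) x
    1≤d : 1# ≤ u - Ũ k x
    1≤d = proj₁ (Ũ-growth 1≤x k)
    1≤u : 1# ≤ u
    1≤u = proj₂ (Ũ-growth 1≤x k)
    d′≈ : Ũ (suc (suc k)) x - u ≈ ((x + x) - (1# + 1#)) * u + (u - Ũ k x)
    d′≈ = solve 3 (λ x u v → ((x :+ x) :* u :- v) :- u := ((x :+ x) :- (con (+ 1) :+ con (+ 1))) :* u :+ (u :- v)) refl x u (Ũ k x)
    1≤d′ : 1# ≤ Ũ (suc (suc k)) x - u
    1≤d′ = ≤-trans (inj₂ (sym (+-identityˡ 1#)))
             (≤-trans (+-mono-≤ (*-nonNeg (x≤y⇒0≤y-x (+-mono-≤ 1≤x 1≤x)) (≤-trans (<⇒≤ 0<1) 1≤u)) 1≤d) (inj₂ (sym d′≈)))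
    1≤u+d′ : 1# ≤ u + (Ũ (suc (suc k)) x - u)
    1≤u+d′ = ≤-trans (<⇒≤ (<-by-difference 1# 0<1 (solve 1 (λ o → (o :+ o) :- o := o) refl 1#))) (+-mono-≤ 1≤u 1≤d′)

module LeastZeroInterlacing {c ℓ} (R : RealClosedField c ℓ) where
  open OrderedFieldProperties R
  open PolynomialArithmetic commutativeRing
  open DerivativeSign R using (polynomial-ivt-↓)
  open ZeroIsolation R using (least-zero)
  open ChebyshevPolynomials R using (sign; sign≉0)
  open RCF R using (IsMinZero)

  module LeastZeros (F : ℕ → Carrier → Carrier) (F-isPolynomial : ∀ k → IsPolynomial (F k))
                    (F-recurrence : ∀ k x → F (suc (suc k)) x ≈ (x + x) * F (suc k) x - F k x)
                    (F-sign : ∀ k y → y ≤ - 1# → 0# < sign k * F k y)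
                    (r₁ : Carrier) (r₁-least : IsMinZero (F 1) r₁) (-1<r₁ : - 1# < r₁) (0<F₀r₁ : 0# < F 0 r₁) where

    signed-isPolynomial : ∀ k → IsPolynomial (λ y → sign k * F k y)
    signed-isPolynomial k = constᴾ (sign k) *ᴾ F-isPolynomial k

    zero⇒signed-zero : ∀ k {y} → F k y ≈ 0# → sign k * F k y ≈ 0#
    zero⇒signed-zero k Fy≈0 = trans (*-congˡ Fy≈0) (zeroʳ _)

    signed-zero⇒zero : ∀ k {y} → sign k * F k y ≈ 0# → F k y ≈ 0#
    signed-zero⇒zero k = x≉0⇒x*y≈0⇒y≈0 (sign≉0 k)

    sign-below-least-zero : ∀ k {σ} → IsMinZero (F k) σ → ∀ y → y < σ → 0# < sign k * F k y
    sign-below-least-zero k {σ} (_ , σ-least) y y<σ with ≤-<-total y (- 1#) | compare (sign k * F k y) 0#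
    ... | inj₁ y≤-1 | _           = F-sign k y y≤-1
    ... | inj₂ _    | tri> _ _ 0<sFy = 0<sFy
    ... | inj₂ _    | tri≈ _ sFy≈0 _ = contradiction y<σ (≤⇒≯ (σ-least y (signed-zero⇒zero k sFy≈0)))
    ... | inj₂ -1<y | tri< sFy<0 _ _ =
      let z , _ , z<y , sFz≈0 = polynomial-ivt-↓ (signed-isPolynomial k) -1<y (F-sign k (- 1#) ≤-refl) sFy<0 in
      contradiction (<-trans z<y y<σ) (≤⇒≯ (σ-least z (signed-zero⇒zero k sFz≈0)))

    record LeastZero (k : ℕ) : Set (c ⊔ ℓ) where
      field
        σ             : Carrier
        σ-least       : IsMinZero (F (suc k)) σ
        -1<σ          : - 1# < σ
        previous-sign : 0# < sign k * F k σ

    -- At the least zero σ of F (k + 1) the recurrence gives F (k + 2) the sign opposite to that of F k,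
    -- while at −1 it has the sign (−1)^k, so F (k + 2) has a zero in (−1, σ).
    next : ∀ {k} → (z : LeastZero k) → Σ (LeastZero (suc k)) λ z′ → LeastZero.σ z′ < LeastZero.σ z
    next {k} z = from-zero (polynomial-ivt-↓ (signed-isPolynomial k₂) -1<σ (F-sign k₂ (- 1#) ≤-refl) sF₂σ<0)
      where
      open LeastZero z
      k₂ = suc (suc k)
      sF₂σ≈-sFσ : sign k₂ * F k₂ σ ≈ - (sign k * F k σ)
      sF₂σ≈-sFσ = trans (*-congˡ (trans (F-recurrence k σ) (+-congʳ (trans (*-congˡ (proj₁ σ-least)) (zeroʳ _)))))
                        (solve 2 (λ s f → (:- (:- s)) :* (con (+ 0) :- f) := :- (s :* f)) refl (sign k) (F k σ))
      sF₂σ<0 : sign k₂ * F k₂ σ < 0#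
      sF₂σ<0 = <-respˡ-≈ (sym sF₂σ≈-sFσ) (0<x⇒-x<0 previous-sign)
      no-zero-below-1 : ∀ y → y < - 1# → ¬ F k₂ y ≈ 0#
      no-zero-below-1 y y<-1 Fy≈0 = >⇒≉ (F-sign k₂ y (<⇒≤ y<-1)) (zero⇒signed-zero k₂ Fy≈0)
      zero-above-1 : ∀ {r} → - 1# ≤ r → F k₂ r ≈ 0# → - 1# < r
      zero-above-1 (inj₁ -1<r) _    = -1<r
      zero-above-1 (inj₂ -1≈r) Fr≈0 = contradiction (zero⇒signed-zero k₂ Fr≈0) (>⇒≉ (F-sign k₂ _ (inj₂ (sym -1≈r))))
      from-zero : (∃ λ w → - 1# < w × w < σ × sign k₂ * F k₂ w ≈ 0#) → Σ (LeastZero (suc k)) λ z′ → LeastZero.σ z′ < σ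
      from-zero (w , -1<w , w<σ , sFw≈0) =
        let r , r-least , -1≤r , r≤w = least-zero (F-isPolynomial k₂) (<⇒≤ -1<w) (signed-zero⇒zero k₂ sFw≈0) no-zero-below-1
            r<σ = ≤-<-trans r≤w w<σ
        in record { σ = r ; σ-least = r-least ; -1<σ = zero-above-1 -1≤r (proj₁ r-least)
                  ; previous-sign = sign-below-least-zero (suc k) σ-least r r<σ } , r<σ

    leastZero : ∀ k → LeastZero k
    leastZero zero    = record { σ = r₁ ; σ-least = r₁-least ; -1<σ = -1<r₁ ; previous-sign = <-respʳ-≈ (sym (*-identityˡ _)) 0<F₀r₁ }
    leastZero (suc k) = proj₁ (next (leastZero k))

    σ : ℕ → Carrier
    σ k = LeastZero.σ (leastZero k)

    σ-decreasing : ∀ k → σ (suc k) < σ k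
    σ-decreasing k = proj₂ (next (leastZero k))

    σ-antitone : ∀ {j k} → j ℕ.≤ k → σ k ≤ σ j
    σ-antitone j≤k = antitone′ (ℕ.≤⇒≤′ j≤k)
      where
      antitone′ : ∀ {j k} → j ℕ.≤′ k → σ k ≤ σ j
      antitone′ ℕ.≤′-refl         = ≤-refl
      antitone′ (ℕ.≤′-step j≤′k) = ≤-trans (<⇒≤ (σ-decreasing _)) (antitone′ j≤′k)

module MinimalZeros {c ℓ} (R : RealClosedField c ℓ) where
  open OrderedFieldProperties R
  open PolynomialArithmetic commutativeRing
  open ChebyshevPolynomials R
  open DerivativeSign R using (polynomial-ivt-↑)
  open ZeroIsolation R using (least-zero)
  open LeastZeroInterlacing R
  open RCF R using (Ũ; U; Uprev; Ue; Seven; Sodd; S; φ; IsMinZero; IsMinOf)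
  open SetoidReasoning setoid

  2*m≡m+m : ∀ m → 2 ℕ.* m ≡ m ℕ.+ m
  2*m≡m+m m = ≡.cong (m ℕ.+_) (ℕ.+-identityʳ m)

  halfParity-even : ∀ m → halfParity (2 ℕ.* m) ≡ inj₁ m
  halfParity-even zero    = ≡.refl
  halfParity-even (suc m) = ≡.trans (≡.cong halfParity (ℕ.*-distribˡ-+ 2 1 m))
                                    (≡.cong [ inj₂ , inj₁ ∘ suc ]′ (≡.cong [ inj₂ , inj₁ ∘ suc ]′ (halfParity-even m)))

  halfParity-odd : ∀ m → halfParity (suc (2 ℕ.* m)) ≡ inj₂ m
  halfParity-odd m rewrite halfParity-even m = ≡.refl

  W : ℕ → Carrier → Carrier
  W m x = U m x + Uprev m x

  Ue-even : ∀ m x → Ue (2 ℕ.* m) x ≡ W m x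
  Ue-even m x rewrite halfParity-even m = ≡.refl

  Ue-odd : ∀ m x → Ue (suc (2 ℕ.* m)) x ≡ U m x
  Ue-odd m x rewrite halfParity-odd m = ≡.refl

  S-even : ∀ m x → S (2 ℕ.* m) x ≡ Seven m x
  S-even m x rewrite halfParity-even m = ≡.refl

  S-odd : ∀ m x → S (suc (2 ℕ.* m)) x ≡ Sodd m x
  S-odd m x rewrite halfParity-odd m = ≡.refl

  Ũ-index : ∀ {i j} x → i ≡ j → Ũ i x ≈ Ũ j x
  Ũ-index x ≡.refl = refl

  -- The addition formula gives U_{2m} = U_m² − U_{m−1}², U_{2m−1} = U_{m−1} (U_m − U_{m−2}) and U_{2m+1} = U_m (U_{m+1} − U_{m−1});
  -- with Cassini's identity U_{m−1}² − U_m U_{m−2} = 1 both factorisations become polynomial identities.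
  φ-factorisation-even : ∀ m x → φ (2 ℕ.* suc m) x ≈ (x - 1#) * (W (suc m) x * Seven (suc m) x)
  φ-factorisation-even m x = begin
    φ n x
      ≈⟨ +-cong (*-congˡ (trans (Ũ-index x (≡.cong suc (2*m≡m+m (suc m)))) (Ũ-addition (suc m) (suc m) x)))
                (*-congˡ (+-congʳ (trans (Ũ-index x n≡) (Ũ-addition (suc m) m x)))) ⟩
    ((((1# + M) * (x * x)) - (three * x)) - M) * (a * a - b * b) + (x + 1#) * ((a * b - b * d) + 1#)
      ≈⟨ solve 4 (λ x b d M → ((((con (+ 1) :+ M) :* (x :* x)) :- (⌜ 3 ⌝ :* x)) :- M) :* (A x b d :* A x b d :- b :* b) :+ (x :+ con (+ 1)) :* ((A x b d :* b :- b :* d) :+ con (+ 1))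
                            := (x :- con (+ 1)) :* ((A x b d :+ b) :* ((((M :* x) :+ x :+ M) :- con (+ 1)) :* A x b d :- ((M :* x) :+ (⌜ 3 ⌝ :* x) :+ M :+ con (+ 1)) :* b)) :- (x :+ con (+ 1)) :* (b :* b :- A x b d :* d :- con (+ 1))) refl x b d M ⟩
    (x - 1#) * (W (suc m) x * Seven (suc m) x) - (x + 1#) * (b * b - a * d - 1#)
      ≈⟨ +-congˡ (-‿cong (*-congˡ (trans (+-congʳ (Ũ-cassini m x)) (-‿inverseʳ 1#)))) ⟩
    (x - 1#) * (W (suc m) x * Seven (suc m) x) - (x + 1#) * 0#
      ≈⟨ solve 2 (λ y z → y :- z :* con (+ 0) := y) refl _ (x + 1#) ⟩
    (x - 1#) * (W (suc m) x * Seven (suc m) x)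
      ∎
    where
    n = 2 ℕ.* suc m
    M = fromℕ n
    three = fromℕ 3
    a = Ũ (suc (suc m)) x
    b = Ũ (suc m) x
    d = Ũ m x
    n≡ : n ≡ suc (suc m ℕ.+ m)
    n≡ = ≡.trans (2*m≡m+m (suc m)) (≡.cong suc (ℕ.+-suc m m))
    A = λ x b d → (x :+ x) :* b :- d

  φ-factorisation-odd : ∀ m x → φ (suc (2 ℕ.* suc m)) x ≈ (x - 1#) * (U (suc m) x * Sodd (suc m) x)
  φ-factorisation-odd m x = begin
    φ n x
      ≈⟨ +-cong (*-congˡ (trans (Ũ-index x suc-n≡) (Ũ-addition (suc m) (suc (suc m)) x)))
                (*-congˡ (+-congʳ (trans (Ũ-index x (≡.cong suc (2*m≡m+m (suc m)))) (Ũ-addition (suc m) (suc m) x)))) ⟩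
    ((((1# + (1# + M)) * (x * x)) - (three * x)) - (1# + M)) * (a * ((x + x) * a - b) - b * a) + (x + 1#) * ((a * a - b * b) + 1#)
      ≈⟨ solve 4 (λ x a b M → ((((con (+ 1) :+ (con (+ 1) :+ M)) :* (x :* x)) :- (⌜ 3 ⌝ :* x)) :- (con (+ 1) :+ M)) :* (a :* ((x :+ x) :* a :- b) :- b :* a) :+ (x :+ con (+ 1)) :* ((a :* a :- b :* b) :+ con (+ 1))
                            := (x :- con (+ 1)) :* (a :* ((⌜ 2 ⌝ :* ((((M :* (x :* x)) :+ (⌜ 2 ⌝ :* (x :* x)) :+ (M :* x)) :- x) :- con (+ 1))) :* a :- (⌜ 2 ⌝ :* ((M :* x) :+ (⌜ 3 ⌝ :* x) :+ M :+ con (+ 1))) :* b)) :- (x :+ con (+ 1)) :* (a :* a :- ((x :+ x) :* a :- b) :* b :- con (+ 1))) refl x a b M ⟩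
    (x - 1#) * (U (suc m) x * Sodd (suc m) x) - (x + 1#) * (a * a - ((x + x) * a - b) * b - 1#)
      ≈⟨ +-congˡ (-‿cong (*-congˡ (trans (+-congʳ (Ũ-cassini (suc m) x)) (-‿inverseʳ 1#)))) ⟩
    (x - 1#) * (U (suc m) x * Sodd (suc m) x) - (x + 1#) * 0#
      ≈⟨ solve 2 (λ y z → y :- z :* con (+ 0) := y) refl _ (x + 1#) ⟩
    (x - 1#) * (U (suc m) x * Sodd (suc m) x)
      ∎
    where
    n = suc (2 ℕ.* suc m)
    M = fromℕ (2 ℕ.* suc m)
    three = fromℕ 3
    a = Ũ (suc (suc m)) x
    b = Ũ (suc m) x
    suc-n≡ : suc n ≡ suc (suc m ℕ.+ suc (suc m))
    suc-n≡ = ≡.cong suc (≡.trans (≡.cong suc (2*m≡m+m (suc m))) (≡.sym (ℕ.+-suc (suc m) (suc m))))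

  Seven-one : ∀ m → Seven m 1# ≈ 0#
  Seven-one m = begin
    Seven m 1#
      ≈⟨ +-cong (*-congˡ (Ũ-one (suc m))) (-‿cong (*-congˡ (Ũ-one m))) ⟩
    ((((M * 1#) + 1# + M) - 1#) * (1# + fm)) - (((M * 1#) + (fromℕ 3 * 1#) + M + 1#) * fm)
      ≈⟨ solve 2 (λ M fm → ((((M :* con (+ 1)) :+ con (+ 1) :+ M) :- con (+ 1)) :* (con (+ 1) :+ fm)) :- (((M :* con (+ 1)) :+ (⌜ 3 ⌝ :* con (+ 1)) :+ M :+ con (+ 1)) :* fm)
                         := (con (+ 1) :+ con (+ 1)) :* (M :- (fm :+ fm))) refl M fm ⟩
    (1# + 1#) * (M - (fm + fm))
      ≈⟨ *-congˡ (trans (+-congʳ (fromℕ-double m)) (-‿inverseʳ _)) ⟩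
    (1# + 1#) * 0#
      ≈⟨ zeroʳ _ ⟩
    0# ∎
    where
    M = fromℕ (2 ℕ.* m)
    fm = fromℕ m

  Sodd-one : ∀ m → Sodd m 1# ≈ 0#
  Sodd-one m = begin
    Sodd m 1#
      ≈⟨ +-cong (*-congˡ (Ũ-one (suc m))) (-‿cong (*-congˡ (Ũ-one m))) ⟩
    (two * ((((M * (1# * 1#)) + (two * (1# * 1#)) + (M * 1#)) - 1#) - 1#)) * (1# + fm) - (two * ((M * 1#) + (fromℕ 3 * 1#) + M + 1#)) * fm
      ≈⟨ solve 2 (λ M fm → (⌜ 2 ⌝ :* ((((M :* (con (+ 1) :* con (+ 1))) :+ (⌜ 2 ⌝ :* (con (+ 1) :* con (+ 1))) :+ (M :* con (+ 1))) :- con (+ 1)) :- con (+ 1))) :* (con (+ 1) :+ fm) :- (⌜ 2 ⌝ :* ((M :* con (+ 1)) :+ (⌜ 3 ⌝ :* con (+ 1)) :+ M :+ con (+ 1))) :* fm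
                         := con (+ 4) :* (M :- (fm :+ fm))) refl M fm ⟩
    (1# + 1# + 1# + 1#) * (M - (fm + fm))
      ≈⟨ *-congˡ (trans (+-congʳ (fromℕ-double m)) (-‿inverseʳ _)) ⟩
    (1# + 1# + 1# + 1#) * 0#
      ≈⟨ zeroʳ _ ⟩
    0# ∎
    where
    M = fromℕ (2 ℕ.* m)
    fm = fromℕ m
    two = fromℕ 2

  U-isPolynomial : ∀ m → IsPolynomial (U m)
  U-isPolynomial m = Ũ-isPolynomial (suc m)

  W-isPolynomial : ∀ m → IsPolynomial (W m)
  W-isPolynomial m = Ũ-isPolynomial (suc m) +ᴾ Ũ-isPolynomial m

  Seven-isPolynomial : ∀ m → IsPolynomial (Seven m)
  Seven-isPolynomial m =
    (constᴾ M *ᴾ idᴾ +ᴾ idᴾ +ᴾ constᴾ M −ᴾ constᴾ 1#) *ᴾ Ũ-isPolynomial (suc m)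
    −ᴾ (constᴾ M *ᴾ idᴾ +ᴾ constᴾ (fromℕ 3) *ᴾ idᴾ +ᴾ constᴾ M +ᴾ constᴾ 1#) *ᴾ Ũ-isPolynomial m
    where M = fromℕ (2 ℕ.* m)

  Sodd-isPolynomial : ∀ m → IsPolynomial (Sodd m)
  Sodd-isPolynomial m =
    constᴾ two *ᴾ (constᴾ M *ᴾ (idᴾ *ᴾ idᴾ) +ᴾ constᴾ two *ᴾ (idᴾ *ᴾ idᴾ) +ᴾ constᴾ M *ᴾ idᴾ −ᴾ idᴾ −ᴾ constᴾ 1#) *ᴾ Ũ-isPolynomial (suc m)
    −ᴾ constᴾ two *ᴾ (constᴾ M *ᴾ idᴾ +ᴾ constᴾ (fromℕ 3) *ᴾ idᴾ +ᴾ constᴾ M +ᴾ constᴾ 1#) *ᴾ Ũ-isPolynomial m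
    where M   = fromℕ (2 ℕ.* m)
          two = fromℕ 2

  φ-isPolynomial : ∀ n → IsPolynomial (φ n)
  φ-isPolynomial n =
    (constᴾ (fromℕ (suc n)) *ᴾ (idᴾ *ᴾ idᴾ) −ᴾ constᴾ (fromℕ 3) *ᴾ idᴾ −ᴾ constᴾ (fromℕ n)) *ᴾ U-isPolynomial n
    +ᴾ (idᴾ +ᴾ constᴾ 1#) *ᴾ (Ũ-isPolynomial n +ᴾ constᴾ 1#)

  signed-U≈ : ∀ k y → sign k * U k y ≈ Ũ (suc k) (- y)
  signed-U≈ k y = sym (trans (Ũ-reflect (suc k) y) (*-congʳ (sign-suc-suc k)))

  signed-W≈ : ∀ k y → sign k * W k y ≈ Ũ (suc k) (- y) - Ũ k (- y)
  signed-W≈ k y = begin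
    sign k * (Ũ (suc k) y + Ũ k y)                         ≈⟨ solve 3 (λ s a b → s :* (a :+ b) := (:- (:- s)) :* a :- (:- s) :* b) refl (sign k) (Ũ (suc k) y) (Ũ k y) ⟩
    sign (suc (suc k)) * Ũ (suc k) y - sign (suc k) * Ũ k y ≈⟨ +-cong (Ũ-reflect (suc k) y) (-‿cong (Ũ-reflect k y)) ⟨
    Ũ (suc k) (- y) - Ũ k (- y)                            ∎

  1≤-y : ∀ {y} → y ≤ - 1# → 1# ≤ - y
  1≤-y y≤-1 = ≤-trans (inj₂ (sym (⁻¹-involutive 1#))) (neg-antimono-≤ y≤-1)

  U-sign : ∀ k y → y ≤ - 1# → 0# < sign k * U k y
  U-sign k y y≤-1 = <-respʳ-≈ (sym (signed-U≈ k y)) (<-≤-trans 0<1 (proj₂ (Ũ-growth (1≤-y y≤-1) k)))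

  W-sign : ∀ k y → y ≤ - 1# → 0# < sign k * W k y
  W-sign k y y≤-1 = <-respʳ-≈ (sym (signed-W≈ k y)) (<-≤-trans 0<1 (proj₁ (Ũ-growth (1≤-y y≤-1) k)))

  U-recurrence : ∀ k x → U (suc (suc k)) x ≈ (x + x) * U (suc k) x - U k x
  U-recurrence k x = refl

  W-recurrence : ∀ k x → W (suc (suc k)) x ≈ (x + x) * W (suc k) x - W k x
  W-recurrence k x = solve 3 (λ x a b → ((x :+ x) :* ((x :+ x) :* a :- b) :- a) :+ ((x :+ x) :* a :- b) := (x :+ x) :* (((x :+ x) :* a :- b) :+ a) :- (a :+ b)) refl x (Ũ (suc k) x) (Ũ k x)

  U₁-least : IsMinZero (U 1) 0#
  U₁-least = solve 0 ((con (+ 0) :+ con (+ 0)) :* con (+ 1) :- con (+ 0) := con (+ 0)) refl ,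
             λ y U₁y≈0 → inj₂ (sym (x≉0⇒x*y≈0⇒y≈0 two≉0 (trans (solve 1 (λ y → (con (+ 1) :+ con (+ 1)) :* y := (y :+ y) :* con (+ 1) :- con (+ 0)) refl y) U₁y≈0)))

  W₁-least : IsMinZero (W 1) (- ½)
  W₁-least = W₁≈0 , λ y W₁y≈0 → inj₂ (sym (zero⇒-½ y W₁y≈0))
    where
    W₁≈2x+1 : ∀ x → W 1 x ≈ (1# + 1#) * x + 1#
    W₁≈2x+1 = solve 1 (λ x → ((x :+ x) :* con (+ 1) :- con (+ 0)) :+ con (+ 1) := (con (+ 1) :+ con (+ 1)) :* x :+ con (+ 1))  refl
    W₁≈0 : W 1 (- ½) ≈ 0#
    W₁≈0 = trans (W₁≈2x+1 (- ½)) (trans (solve 1 (λ h → (con (+ 1) :+ con (+ 1)) :* (:- h) :+ con (+ 1) := :- ((con (+ 1) :+ con (+ 1)) :* h) :+ con (+ 1)) refl ½)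
                                        (trans (+-congʳ (-‿cong 2*½≈1)) (-‿inverseˡ 1#)))
    zero⇒-½ : ∀ y → W 1 y ≈ 0# → y ≈ - ½
    zero⇒-½ y W₁y≈0 = x-y≈0⇒x≈y (x≉0⇒x*y≈0⇒y≈0 two≉0 (begin
      (1# + 1#) * (y - - ½)               ≈⟨ solve 2 (λ y h → (con (+ 1) :+ con (+ 1)) :* (y :- :- h) := ((con (+ 1) :+ con (+ 1)) :* y :+ con (+ 1)) :+ ((con (+ 1) :+ con (+ 1)) :* h :- con (+ 1))) refl y ½ ⟩
      ((1# + 1#) * y + 1#) + ((1# + 1#) * ½ - 1#) ≈⟨ +-cong (trans (sym (W₁≈2x+1 y)) W₁y≈0) (trans (+-congʳ 2*½≈1) (-‿inverseʳ 1#)) ⟩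
      0# + 0#                             ≈⟨ +-identityʳ 0# ⟩
      0#                                  ∎))

  module U-zeros = LeastZeros U U-isPolynomial U-recurrence U-sign 0# U₁-least (0<x⇒-x<0 0<1) 0<1
  module W-zeros = LeastZeros W W-isPolynomial W-recurrence W-sign (- ½) W₁-least (neg-antimono-< ½<1) (<-respʳ-≈ (sym (+-identityʳ 1#)) 0<1)

  module EvenCase (m : ℕ) where
    k : ℕ
    k = suc m

    K : Carrier
    K = fromℕ k

    β : Carrier
    β = W-zeros.σ m

    module BelowLeastZero {y : Carrier} (y<β : y < β) where
      signed-W-pos : ∀ j → j ℕ.≤ k → 0# < sign j * W j y
      signed-W-pos zero    _         = <-respʳ-≈ (sym (trans (*-identityˡ _) (+-identityʳ 1#))) 0<1
      signed-W-pos (suc i) (s≤s i≤m) = W-zeros.sign-below-least-zero (suc i) (W-zeros.LeastZero.σ-least (W-zeros.leastZero i)) y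
                                          (<-≤-trans y<β (W-zeros.σ-antitone i≤m))

      Ũ-reflected-≥1 : ∀ j → j ℕ.≤ k → 1# ≤ Ũ (suc j) (- y)
      Ũ-reflected-≥1 zero    _     = ≤-refl
      Ũ-reflected-≥1 (suc j) j<k = ≤-trans (inj₂ (sym (+-identityʳ 1#)))
        (≤-trans (+-mono-≤ (Ũ-reflected-≥1 j (ℕ.<⇒≤ j<k)) (<⇒≤ (<-respʳ-≈ (signed-W≈ (suc j) y) (signed-W-pos (suc j) j<k))))
                 (inj₂ (solve 2 (λ a b → b :+ (a :- b) := a) refl (Ũ (suc (suc j)) (- y)) (Ũ (suc j) (- y)))))

      -- Telescoping the recurrence: each step adds 2(1 + y)(1 − Ũ (j + 1) (− y)) ≤ 0.
      telescoping-bound : - 1# ≤ y → ∀ j → j ℕ.≤ k → sign j * W j y + fromℕ j * ((1# + y) + (1# + y)) ≤ 1#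
      telescoping-bound -1≤y zero    _   = inj₂ (trans (+-cong (trans (*-identityˡ _) (+-identityʳ 1#)) (zeroˡ _)) (+-identityʳ 1#))
      telescoping-bound -1≤y (suc j) j<k = ≤-trans (inj₂ step) (≤-trans (+-mono-≤ (telescoping-bound -1≤y j (ℕ.<⇒≤ j<k)) increment≤0) (inj₂ (+-identityʳ 1#)))
        where
        e = 1# + y
        V₁ = Ũ (suc j) (- y)
        V₀ = Ũ j (- y)
        0≤e : 0# ≤ e
        0≤e = ≤-trans (x≤y⇒0≤y-x -1≤y) (inj₂ (solve 1 (λ y → y :- :- con (+ 1) := con (+ 1) :+ y) refl y))
        increment≤0 : (e + e) * (1# - V₁) ≤ 0#
        increment≤0 = *-nonNeg-nonPos (+-nonNeg 0≤e 0≤e) (x≤y⇒x-y≤0 (Ũ-reflected-≥1 j (ℕ.<⇒≤ j<k)))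
        step : sign (suc j) * W (suc j) y + (1# + fromℕ j) * (e + e) ≈ (sign j * W j y + fromℕ j * (e + e)) + (e + e) * (1# - V₁)
        step = begin
          sign (suc j) * W (suc j) y + (1# + fromℕ j) * (e + e)        ≈⟨ +-congʳ (signed-W≈ (suc j) y) ⟩
          ((- y + - y) * V₁ - V₀ - V₁) + (1# + fromℕ j) * (e + e)       ≈⟨ solve 4 (λ y f V₁ V₀ → ((:- y :+ :- y) :* V₁ :- V₀ :- V₁) :+ (con (+ 1) :+ f) :* ((con (+ 1) :+ y) :+ (con (+ 1) :+ y))
                                                                                   := ((V₁ :- V₀) :+ f :* ((con (+ 1) :+ y) :+ (con (+ 1) :+ y))) :+ ((con (+ 1) :+ y) :+ (con (+ 1) :+ y)) :* (con (+ 1) :- V₁)) refl y (fromℕ j) V₁ V₀ ⟩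
          ((V₁ - V₀) + fromℕ j * (e + e)) + (e + e) * (1# - V₁)        ≈⟨ +-congʳ (+-congʳ (signed-W≈ j y)) ⟨
          (sign j * W j y + fromℕ j * (e + e)) + (e + e) * (1# - V₁)   ∎

      L : Carrier
      L = (K + 1#) * y + K

      L<0-below : y ≤ - 1# → L < 0#
      L<0-below y≤-1 = <-respˡ-≈ (sym L≈) (+-nonPos-neg (*-nonNeg-nonPos (<⇒≤ (+-pos-nonNeg (0<fromℕ-suc m) (<⇒≤ 0<1))) y+1≤0) (0<x⇒-x<0 0<1))
        where
        L≈ : L ≈ (K + 1#) * (y + 1#) + - 1#
        L≈ = solve 2 (λ K y → (K :+ con (+ 1)) :* y :+ K := (K :+ con (+ 1)) :* (y :+ con (+ 1)) :+ :- con (+ 1)) refl K y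
        y+1≤0 : y + 1# ≤ 0#
        y+1≤0 = ≤-trans (inj₂ (solve 1 (λ y → y :+ con (+ 1) := y :- :- con (+ 1)) refl y)) (x≤y⇒x-y≤0 y≤-1)

      -- If L ≥ 0 then 2K(1 + y) ≥ 1, which together with sign k W_k (y) > 0 contradicts telescoping-bound.
      L<0-above : - 1# < y → L < 0#
      L<0-above -1<y = [ (λ 0≤L → contradiction (1<Δ 0≤L) (≤⇒≯ (telescoping-bound (<⇒≤ -1<y) k ℕ.≤-refl))) , id ]′ (≤-<-total 0# L)
        where
        e = 1# + y
        0<e : 0# < e
        0<e = <-respʳ-≈ (solve 1 (λ y → y :- :- con (+ 1) := con (+ 1) :+ y) refl y) (x<y⇒0<y-x -1<y)
        2Ke≈ : K * (e + e) ≈ (L + 1#) + fromℕ m * e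
        2Ke≈ = solve 2 (λ k y → (con (+ 1) :+ k) :* ((con (+ 1) :+ y) :+ (con (+ 1) :+ y)) := (((con (+ 1) :+ k) :+ con (+ 1)) :* y :+ (con (+ 1) :+ k)) :+ con (+ 1) :+ k :* (con (+ 1) :+ y)) refl (fromℕ m) y
        1<Δ : 0# ≤ L → 1# < sign k * W k y + K * (e + e)
        1<Δ 0≤L = <-respˡ-≈ (+-identityˡ 1#) (+-mono-<-≤ (signed-W-pos k ℕ.≤-refl) 1≤2Ke)
          where
          1≤2Ke : 1# ≤ K * (e + e)
          1≤2Ke = ≤-trans (inj₂ (sym (trans (+-congʳ (+-identityˡ 1#)) (+-identityʳ 1#))))
                    (≤-trans (+-mono-≤ (+-mono-≤ 0≤L ≤-refl) (*-nonNeg (0≤fromℕ m) (<⇒≤ 0<e))) (inj₂ (sym 2Ke≈)))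

      L<0 : L < 0#
      L<0 = [ L<0-below , L<0-above ]′ (≤-<-total y (- 1#))

      -- sign k · S_{2k} = A · sign k W_k + 4 L · Ũ k (− y), where (K + 1) A = (2K + 1) L − 1.
      signed-Seven<0 : sign k * Seven k y < 0#
      signed-Seven<0 = <-respˡ-≈ (sym sSeven≈) (+-neg-nonPos (*-neg-pos A<0 (signed-W-pos k ℕ.≤-refl))
                                                   (<⇒≤ (*-neg-pos 4L<0 (<-≤-trans 0<1 (Ũ-reflected-≥1 m (ℕ.n≤1+n m))))))
        where
        s = sign k
        a = U k y
        b = Uprev k y
        M = fromℕ (2 ℕ.* k)
        A = ((M * y) + y + M) - 1#
        B = (M * y) + (fromℕ 3 * y) + M + 1#
        four = 1# + 1# + 1# + 1#
        M≈ : M ≈ K + K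
        M≈ = fromℕ-double k
        sSeven≈ : s * Seven k y ≈ A * (s * W k y) + (four * L) * Ũ k (- y)
        sSeven≈ = begin
          s * (A * a - B * b)                              ≈⟨ solve 5 (λ s a b A B → s :* (A :* a :- B :* b) := A :* (s :* (a :+ b)) :+ (A :+ B) :* (:- s :* b)) refl s a b A B ⟩
          A * (s * W k y) + (A + B) * (- s * b)            ≈⟨ +-cong refl (*-cong A+B≈4L (sym (Ũ-reflect k y))) ⟩
          A * (s * W k y) + (four * L) * Ũ k (- y)          ∎
          where
          A+B≈4L : A + B ≈ four * L
          A+B≈4L = begin
            A + B                                   ≈⟨ +-congʳ (+-cong (+-cong (+-cong (*-congʳ M≈) refl) M≈) refl) ⟩
            (((K + K) * y + y + (K + K)) - 1#) + B  ≈⟨ +-congˡ (+-cong (+-cong (+-cong (*-congʳ M≈) refl) M≈) refl) ⟩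
            (((K + K) * y + y + (K + K)) - 1#) + ((K + K) * y + fromℕ 3 * y + (K + K) + 1#)
              ≈⟨ solve 2 (λ K y → (((K :+ K) :* y :+ y :+ (K :+ K)) :- con (+ 1)) :+ ((K :+ K) :* y :+ ⌜ 3 ⌝ :* y :+ (K :+ K) :+ con (+ 1)) := con (+ 4) :* ((K :+ con (+ 1)) :* y :+ K)) refl K y ⟩
            four * L                                ∎
        A<0 : A < 0#
        A<0 = pos∧*-neg⇒neg (+-pos-nonNeg (0<fromℕ-suc m) (<⇒≤ 0<1)) (<-respˡ-≈ (sym [K+1]A≈) (+-neg-nonPos (*-pos-neg 0<2K+1 L<0) (<⇒≤ (0<x⇒-x<0 0<1))))
          where
          0<2K+1 : 0# < (K + K) + 1#
          0<2K+1 = +-nonNeg-pos (+-nonNeg (0≤fromℕ k) (0≤fromℕ k)) 0<1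
          [K+1]A≈ : (K + 1#) * A ≈ ((K + K) + 1#) * L + - 1#
          [K+1]A≈ = trans (*-congˡ (+-congʳ (+-cong (+-cong (*-congʳ M≈) refl) M≈)))
                          (solve 2 (λ K y → (K :+ con (+ 1)) :* (((K :+ K) :* y :+ y :+ (K :+ K)) :- con (+ 1)) := ((K :+ K) :+ con (+ 1)) :* ((K :+ con (+ 1)) :* y :+ K) :+ :- con (+ 1)) refl K y)
        4L<0 : four * L < 0#
        4L<0 = *-pos-neg 0<4 L<0

    Seven-no-zero-below : ∀ y → y < β → ¬ Seven k y ≈ 0#
    Seven-no-zero-below y y<β Seven≈0 = <⇒≉ (BelowLeastZero.signed-Seven<0 y<β) (trans (*-congˡ Seven≈0) (zeroʳ _))

  Sodd-no-zero-below-1 : ∀ m y → y ≤ - 1# → ¬ Sodd (suc m) y ≈ 0#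
  Sodd-no-zero-below-1 m y y≤-1 Sodd≈0 = >⇒≉ 0<sSodd (trans (*-congˡ Sodd≈0) (zeroʳ _))
    where
    k = suc m
    s = sign k
    a = Ũ (suc k) y
    b = Ũ k y
    M = fromℕ (2 ℕ.* k)
    two = fromℕ 2
    three = fromℕ 3
    A = (((M * (y * y)) + (two * (y * y)) + (M * y)) - y) - 1#
    B = (M * y) + (three * y) + M + 1#
    u = - 1# - y
    sSodd≈ : s * Sodd k y ≈ two * (A * (s * W k y) + (A + B) * Ũ k (- y))
    sSodd≈ = trans (solve 6 (λ s a b A B t → s :* ((t :* A) :* a :- (t :* B) :* b) := t :* (A :* (s :* (a :+ b)) :+ (A :+ B) :* (:- s :* b))) refl s a b A B two)
                   (*-congˡ (+-congˡ (*-congˡ (sym (Ũ-reflect k y)))))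
    -- As polynomials in u = −1 − y ≥ 0, A and A + B have nonnegative coefficients.
    A≈ : A ≈ two + ((M + two) + three) * u + ((M + two) * u) * u
    A≈ = solve 2 (λ M y → ((((M :* (y :* y)) :+ (⌜ 2 ⌝ :* (y :* y)) :+ (M :* y)) :- y) :- con (+ 1)) := ⌜ 2 ⌝ :+ ((M :+ ⌜ 2 ⌝) :+ ⌜ 3 ⌝) :* (:- con (+ 1) :- y) :+ ((M :+ ⌜ 2 ⌝) :* (:- con (+ 1) :- y)) :* (:- con (+ 1) :- y)) refl M y
    A+B≈ : A + B ≈ u * (two + (M + two) * u)
    A+B≈ = solve 2 (λ M y → (((((M :* (y :* y)) :+ (⌜ 2 ⌝ :* (y :* y)) :+ (M :* y)) :- y) :- con (+ 1)) :+ ((M :* y) :+ (⌜ 3 ⌝ :* y) :+ M :+ con (+ 1))) := (:- con (+ 1) :- y) :* (⌜ 2 ⌝ :+ (M :+ ⌜ 2 ⌝) :* (:- con (+ 1) :- y))) refl M y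
    0≤u : 0# ≤ u
    0≤u = x≤y⇒0≤y-x y≤-1
    0<two : 0# < two
    0<two = 0<fromℕ-suc 1
    0≤M+two : 0# ≤ M + two
    0≤M+two = +-nonNeg (0≤fromℕ (2 ℕ.* k)) (<⇒≤ 0<two)
    0<A : 0# < A
    0<A = <-respʳ-≈ (sym A≈) (+-pos-nonNeg (+-pos-nonNeg 0<two (*-nonNeg (+-nonNeg 0≤M+two (0≤fromℕ 3)) 0≤u)) (*-nonNeg (*-nonNeg 0≤M+two 0≤u) 0≤u))
    0≤A+B : 0# ≤ A + B
    0≤A+B = ≤-trans (*-nonNeg 0≤u (+-nonNeg (<⇒≤ 0<two) (*-nonNeg 0≤M+two 0≤u))) (inj₂ (sym A+B≈))
    0<sSodd : 0# < s * Sodd k y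
    0<sSodd = <-respʳ-≈ (sym sSodd≈) (*-pos 0<two (+-pos-nonNeg (*-pos 0<A (W-sign k y y≤-1))
                                                      (*-nonNeg 0≤A+B (<⇒≤ (<-≤-trans 0<1 (proj₂ (Ũ-growth (1≤-y y≤-1) m)))))))

  least-zero-of-product : ∀ {h f g : Carrier → Carrier} {β γ} → (∀ x → h x ≈ (x - 1#) * (f x * g x)) →
                          IsMinZero f β → IsMinZero g γ → β ≤ γ → γ ≤ 1# → IsMinZero h β
  least-zero-of-product {h} {f} {g} {β} h≈ (fβ≈0 , β-least) (_ , γ-least) β≤γ γ≤1 = hβ≈0 , β-least-for-h
    where
    hβ≈0 : h β ≈ 0#
    hβ≈0 = trans (h≈ β) (trans (*-congˡ (trans (*-congʳ fβ≈0) (zeroˡ _))) (zeroʳ _))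
    β-least-for-h : ∀ y → h y ≈ 0# → β ≤ y
    β-least-for-h y hy≈0 = [ (λ y-1≈0 → ≤-trans β≤γ (≤-trans γ≤1 (inj₂ (sym (x-y≈0⇒x≈y y-1≈0)))))
                           , [ β-least y , (λ gy≈0 → ≤-trans β≤γ (γ-least y gy≈0)) ]′ ∘ x*y≈0⇒x≈0⊎y≈0
                           ]′ (x*y≈0⇒x≈0⊎y≈0 (trans (sym (h≈ y)) hy≈0))

  IsMinZero-resp-≡ : ∀ {f g : Carrier → Carrier} {r} → (∀ x → f x ≡ g x) → IsMinZero g r → IsMinZero f r
  IsMinZero-resp-≡ {f} f≡g (gr≈0 , r-least) = ≡.subst (_≈ 0#) (≡.sym (f≡g _)) gr≈0 , λ y fy≈0 → r-least y (≡.subst (_≈ 0#) (f≡g y) fy≈0)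

  Conclusion : ℕ → Set (c ⊔ ℓ)
  Conclusion n = ∃ λ α → ∃ λ β → ∃ λ γ →
    IsMinZero (φ n) α × IsMinZero (Ue n) β × IsMinZero (S n) γ × IsMinOf α β γ
    × (∀ m → n ≡ 2 ℕ.* m → α ≈ β) × (∀ m → n ≡ 2 ℕ.* m ℕ.+ 1 → α ≈ γ)

  even-conclusion : ∀ m → Conclusion (2 ℕ.* suc m)
  even-conclusion m = from-γ (least-zero (Seven-isPolynomial k) β≤1 (Seven-one k) Seven-no-zero-below)
    where
    open EvenCase m
    β-least : IsMinZero (W k) β
    β-least = W-zeros.LeastZero.σ-least (W-zeros.leastZero m)
    β≤1 : β ≤ 1#
    β≤1 = ≤-trans (W-zeros.σ-antitone {k = m} ℕ.z≤n) (<⇒≤ (<-trans (0<x⇒-x<0 0<½) 0<1))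
    from-γ : (∃ λ γ → IsMinZero (Seven k) γ × β ≤ γ × γ ≤ 1#) → Conclusion (2 ℕ.* k)
    from-γ (γ , γ-least , β≤γ , γ≤1) =
      β , β , γ , least-zero-of-product (φ-factorisation-even m) β-least γ-least β≤γ γ≤1 ,
      IsMinZero-resp-≡ (Ue-even k) β-least , IsMinZero-resp-≡ (S-even k) γ-least ,
      (inj₁ refl , ≤-refl , β≤γ) , (λ _ _ → refl) ,
      λ j 2k≡2j+1 → contradiction (≡.trans 2k≡2j+1 (ℕ.+-comm (2 ℕ.* j) 1)) (ℕ.even≢odd k j)

  module OddCase (m : ℕ) where
    k : ℕ
    k = suc m

    n : ℕ
    n = suc (2 ℕ.* k)

    β : Carrier
    β = U-zeros.σ m

    σₙ : Carrier
    σₙ = U-zeros.σ (2 ℕ.* k)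

    open U-zeros.LeastZero (U-zeros.leastZero (2 ℕ.* k)) using () renaming (σ-least to σₙ-least; -1<σ to -1<σₙ; previous-sign to 0<sUₙ₋₁σₙ)

    β-least : IsMinZero (U k) β
    β-least = U-zeros.LeastZero.σ-least (U-zeros.leastZero m)

    -- Cassini at the zero σₙ of U_n gives U_{n−1}(σₙ)² = 1, and U_{n−1}(σₙ) > 0 by interlacing.
    Uₙ₋₁σₙ≈1 : U (2 ℕ.* k) σₙ ≈ 1#
    Uₙ₋₁σₙ≈1 = [ x-y≈0⇒x≈y , (λ w+1≈0 → contradiction w+1≈0 (>⇒≉ (+-pos-nonNeg 0<w (<⇒≤ 0<1)))) ]′ (x*y≈0⇒x≈0⊎y≈0 [w-1][w+1]≈0)
      where
      w = U (2 ℕ.* k) σₙ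
      0<w : 0# < w
      0<w = <-respʳ-≈ (trans (*-congʳ (sign-double k)) (*-identityˡ w)) 0<sUₙ₋₁σₙ
      ww≈1 : w * w ≈ 1#
      ww≈1 = trans (sym (trans (+-congˡ (-‿cong (trans (*-congʳ (proj₁ σₙ-least)) (zeroˡ _)))) (trans (+-congˡ ε⁻¹≈ε) (+-identityʳ _))))
                   (Ũ-cassini (2 ℕ.* k) σₙ)
      [w-1][w+1]≈0 : (w - 1#) * (w + 1#) ≈ 0#
      [w-1][w+1]≈0 = trans (solve 1 (λ w → (w :- con (+ 1)) :* (w :+ con (+ 1)) := w :* w :- con (+ 1)) refl w) (trans (+-congʳ ww≈1) (-‿inverseʳ 1#))

    0<φσₙ : 0# < φ n σₙ
    0<φσₙ = <-respʳ-≈ (sym φσₙ≈) (*-pos (<-respʳ-≈ (solve 1 (λ y → y :- :- con (+ 1) := y :+ con (+ 1)) refl σₙ) (x<y⇒0<y-x -1<σₙ)) 0<2)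
      where
      φσₙ≈ : φ n σₙ ≈ (σₙ + 1#) * (1# + 1#)
      φσₙ≈ = trans (+-cong (trans (*-congˡ (proj₁ σₙ-least)) (zeroʳ _)) (*-congˡ (+-congʳ Uₙ₋₁σₙ≈1))) (+-identityˡ _)

    φ-1<0 : φ n (- 1#) < 0#
    φ-1<0 = <-respˡ-≈ (sym φ-1≈) (*-pos-neg 0<4 Uₙ-1<0)
      where
      four = 1# + 1# + 1# + 1#
      φ-1≈ : φ n (- 1#) ≈ four * U n (- 1#)
      φ-1≈ = solve 3 (λ N u v → ((((con (+ 1) :+ N) :* ((:- con (+ 1)) :* (:- con (+ 1)))) :- (⌜ 3 ⌝ :* (:- con (+ 1)))) :- N) :* u :+ ((:- con (+ 1)) :+ con (+ 1)) :* (v :+ con (+ 1)) := con (+ 4) :* u)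
                     refl (fromℕ n) (U n (- 1#)) (Ũ n (- 1#))
      Uₙ-1<0 : U n (- 1#) < 0#
      Uₙ-1<0 = <-respˡ-≈ (⁻¹-involutive _) (<-respʳ-≈ ε⁻¹≈ε (neg-antimono-<
                 (<-respʳ-≈ (trans (*-congʳ (-‿cong (sign-double k))) (-1*x≈-x _)) (U-sign n (- 1#) ≤-refl))))
        where open import Algebra.Properties.Ring ring using (-1*x≈-x)

    σₙ≤β : σₙ ≤ β
    σₙ≤β = proj₂ σₙ-least β Uₙβ≈0
      where
      Uₖβ≈0 : U k β ≈ 0#
      Uₖβ≈0 = proj₁ β-least
      Uₙβ≈0 : U n β ≈ 0#
      Uₙβ≈0 = begin
        Ũ (suc n) β                                      ≈⟨ Ũ-index β (≡.cong suc (≡.trans (≡.cong suc (2*m≡m+m k)) (≡.sym (ℕ.+-suc k k)))) ⟩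
        Ũ (suc (k ℕ.+ suc k)) β                          ≈⟨ Ũ-addition k (suc k) β ⟩
        U k β * Ũ (suc (suc k)) β - Ũ k β * U k β        ≈⟨ +-cong (trans (*-congʳ Uₖβ≈0) (zeroˡ _)) (-‿cong (trans (*-congˡ Uₖβ≈0) (zeroʳ _))) ⟩
        0# - 0#                                          ≈⟨ -‿inverseʳ 0# ⟩
        0#                                               ∎

    β<1 : β < 1#
    β<1 = ≤-<-trans (U-zeros.σ-antitone {k = m} ℕ.z≤n) 0<1

    -- φ_n changes sign on (−1, σₙ), and below β only the factor S_n can vanish.
    Sodd-zero-below-β : ∃ λ z → z < β × Sodd k z ≈ 0#
    Sodd-zero-below-β = from-φ-zero (polynomial-ivt-↑ (φ-isPolynomial n) -1<σₙ φ-1<0 0<φσₙ)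
      where
      from-φ-zero : (∃ λ z → - 1# < z × z < σₙ × φ n z ≈ 0#) → ∃ λ z → z < β × Sodd k z ≈ 0#
      from-φ-zero (z , _ , z<σₙ , φz≈0) = z , z<β , x≉0⇒x*y≈0⇒y≈0 Uz≉0 (x≉0⇒x*y≈0⇒y≈0 z-1≉0 (trans (sym (φ-factorisation-odd m z)) φz≈0))
        where
        z<β : z < β
        z<β = <-≤-trans z<σₙ σₙ≤β
        z-1≉0 : ¬ z - 1# ≈ 0#
        z-1≉0 = <⇒≉ (x<y⇒x-y<0 (<-trans z<β β<1))
        Uz≉0 : ¬ U k z ≈ 0#
        Uz≉0 Uz≈0 = ≤⇒≯ (proj₂ β-least z Uz≈0) z<β

  odd-conclusion : ∀ m → Conclusion (suc (2 ℕ.* suc m))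
  odd-conclusion m = from-γ (least-zero (Sodd-isPolynomial k) -1≤1 (Sodd-one k) (λ y y<-1 → Sodd-no-zero-below-1 m y (<⇒≤ y<-1)))
    where
    open OddCase m
    -1≤1 : - 1# ≤ 1#
    -1≤1 = <⇒≤ (<-trans (0<x⇒-x<0 0<1) 0<1)
    from-γ : (∃ λ γ → IsMinZero (Sodd k) γ × - 1# ≤ γ × γ ≤ 1#) → Conclusion n
    from-γ (γ , γ-least , _ , _) =
      γ , β , γ , least-zero-of-product (λ x → trans (φ-factorisation-odd m x) (*-congˡ (*-comm _ _))) γ-least β-least (<⇒≤ γ<β) (<⇒≤ β<1) ,
      IsMinZero-resp-≡ (Ue-odd k) β-least , IsMinZero-resp-≡ (S-odd k) γ-least ,
      (inj₂ refl , <⇒≤ γ<β , ≤-refl) , (λ j n≡2j → contradiction (≡.sym n≡2j) (ℕ.even≢odd j k)) , (λ _ _ → refl)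
      where
      γ<β : γ < β
      γ<β = let z , z<β , Sz≈0 = Sodd-zero-below-β in ≤-<-trans (proj₂ γ-least z Sz≈0) z<β

  parity : ∀ n → (∃ λ m → n ≡ 2 ℕ.* m) ⊎ (∃ λ m → n ≡ suc (2 ℕ.* m))
  parity zero = inj₁ (0 , ≡.refl)
  parity (suc n) with parity n
  ... | inj₁ (m , n≡2m)   = inj₂ (m , ≡.cong suc n≡2m)
  ... | inj₂ (m , n≡2m+1) = inj₁ (suc m , ≡.trans (≡.cong suc n≡2m+1) (≡.sym (ℕ.*-distribˡ-+ 2 1 m)))

  conclusion : ∀ n → 2 ℕ.≤ n → Conclusion n
  conclusion n 2≤n = by-parity (parity n) 2≤n
    where
    by-parity : (∃ λ m → n ≡ 2 ℕ.* m) ⊎ (∃ λ m → n ≡ suc (2 ℕ.* m)) → 2 ℕ.≤ n → Conclusion n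
    by-parity (inj₁ (zero  , ≡.refl)) ()
    by-parity (inj₁ (suc m , ≡.refl)) _         = even-conclusion m
    by-parity (inj₂ (zero  , ≡.refl)) (s≤s ())
    by-parity (inj₂ (suc m , ≡.refl)) _         = odd-conclusion m

  φ₀-least : IsMinZero (φ 0) 1#
  φ₀-least = trans (φ₀≈ 1#) (trans (*-congˡ (-‿inverseʳ 1#)) (zeroʳ _)) , λ y φ₀y≈0 →
             inj₂ (sym (x-y≈0⇒x≈y ([ id , id ]′ (x*y≈0⇒x≈0⊎y≈0 (trans (sym (φ₀≈ y)) φ₀y≈0)))))
    where
    φ₀≈ : ∀ x → φ 0 x ≈ (x - 1#) * (x - 1#)
    φ₀≈ = solve 1 (λ x → (((⌜ 1 ⌝ :* (x :* x)) :- (⌜ 3 ⌝ :* x)) :- con (+ 0)) :* con (+ 1) :+ (x :+ con (+ 1)) :* (con (+ 0) :+ con (+ 1)) := (x :- con (+ 1)) :* (x :- con (+ 1))) refl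

  φ₁-least : ∀ h → h + h ≈ - 1# → IsMinZero (φ 1) h
  φ₁-least h h+h≈-1 = trans (φ₁≈ h) (trans (*-congˡ 2h+1≈0) (zeroʳ _)) , h-least
    where
    φ₁≈ : ∀ x → φ 1 x ≈ ((1# + 1#) * ((x - 1#) * (x - 1#))) * ((x + x) + 1#)
    φ₁≈ = solve 1 (λ x → (((⌜ 2 ⌝ :* (x :* x)) :- (⌜ 3 ⌝ :* x)) :- ⌜ 1 ⌝) :* ((x :+ x) :* con (+ 1) :- con (+ 0)) :+ (x :+ con (+ 1)) :* (con (+ 1) :+ con (+ 1))
                       := ((con (+ 1) :+ con (+ 1)) :* ((x :- con (+ 1)) :* (x :- con (+ 1)))) :* ((x :+ x) :+ con (+ 1))) refl
    2h+1≈0 : (h + h) + 1# ≈ 0#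
    2h+1≈0 = trans (+-congʳ h+h≈-1) (-‿inverseˡ 1#)
    h<1 : h < 1#
    h<1 = <-trans ([ (λ 0≤h → contradiction (<-respˡ-≈ (sym h+h≈-1) (0<x⇒-x<0 0<1)) (≤⇒≯ (+-nonNeg 0≤h 0≤h))) , id ]′ (≤-<-total 0# h)) 0<1
    h-least : ∀ y → φ 1 y ≈ 0# → h ≤ y
    h-least y φ₁y≈0 = [ [ square-zero , square-zero ]′ ∘ x*y≈0⇒x≈0⊎y≈0 ∘ x≉0⇒x*y≈0⇒y≈0 two≉0 , linear-zero ]′ (x*y≈0⇒x≈0⊎y≈0 (trans (sym (φ₁≈ y)) φ₁y≈0))
      where
      square-zero : y - 1# ≈ 0# → h ≤ y
      square-zero y-1≈0 = <⇒≤ (<-respʳ-≈ (sym (x-y≈0⇒x≈y y-1≈0)) h<1)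
      linear-zero : (y + y) + 1# ≈ 0# → h ≤ y
      linear-zero 2y+1≈0 = inj₂ (sym (x-y≈0⇒x≈y (x≉0⇒x*y≈0⇒y≈0 two≉0 (trans (solve 2 (λ y h → (con (+ 1) :+ con (+ 1)) :* (y :- h) := ((y :+ y) :+ con (+ 1)) :- ((h :+ h) :+ con (+ 1))) refl y h)
                                                                      (trans (+-cong 2y+1≈0 (-‿cong 2h+1≈0)) (-‿inverseʳ 0#))))))

open import Data.Nat using (_≤_; _*_; _+_)

theorem4p9 : ∀ {c ℓ : Level} (R : RealClosedField c ℓ) →
    RCF.IsMinZero R (RCF.φ R 0) (RealClosedField.1# R)
    × (∀ h → RealClosedField._≈_ R (RealClosedField._+_ R h h)
                                   (RealClosedField.-_ R (RealClosedField.1# R))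
           → RCF.IsMinZero R (RCF.φ R 1) h)
    × (∀ n → 2 ≤ n →
         ∃ λ α → ∃ λ β → ∃ λ γ →
           RCF.IsMinZero R (RCF.φ R n) α
           × RCF.IsMinZero R (RCF.Ue R n) β
           × RCF.IsMinZero R (RCF.S R n) γ
           × RCF.IsMinOf R α β γ
           × (∀ m → n ≡ 2 * m → RealClosedField._≈_ R α β)
           × (∀ m → n ≡ 2 * m + 1 → RealClosedField._≈_ R α γ))
theorem4p9 R = φ₀-least , φ₁-least , conclusion
  where open MinimalZeros R
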